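{- Let $(D^1,X^1,H^1)$ and $(D^2,X^2,H^2)$ be feasible configurations with $V(D^1)\cap V(D^2)=\emptyset$ and $V(H^1)\cap V(H^2)=\emptyset$, and let $(D,X,H)$ be obtained from them by merging $v^1\in V(D^1)$ and $v^2\in V(D^2)$ to a new vertex $v^*$. Then $(D,X,H)$ is a feasible configuration, and the following are equivalent: (a) both $(D^1,X^1,H^1)$ and $(D^2,X^2,H^2)$ are minimal uncolorable degree-feasible configurations; (b) $(D,X,H)$ is a minimal uncolorable degree-feasible configuration.
   Context: Digraphs are finite, without loops and parallel arcs (opposite arcs allowed); connectivity means weak connectivity. A cover of a digraph $D$ is a pair $(X,H)$: pairwise disjoint sets $X_v$ ($v\in V(D)$), and a digraph $H$ on $\bigcup_v X_v$ with each $X_v$ independent, such that for each arc $uv\in A(D)$ the arcs of $H$ from $X_u$ to $X_v$ form a (possibly empty) matching and every arc of $H$ arises in this way. A feasible configuration is a triple $(D,X,H)$ with $D$ connected and $(X,H)$ a cover of $D$; degree-feasible means $|X_v|\ge\max\{d_D^+(v),d_D^-(v)\}$ for all $v$. It is colorable if there is an acyclic transversal (a set $T\subseteq V(H)$ with $|T\cap X_v|=1$ for all $v$ and $H[T]$ containing no directed cycle), uncolorable otherwise, and minimal uncolorable if uncolorable but $(D,X,H-a)$ is colorable for every arc $a\in A(H)$. Merging: $D$ is obtained from $D^1\cup D^2$ by identifying $v^1$ and $v^2$ into a new vertex $v^*$; $H=H^1\cup H^2$; $X_{v^*}=X^1_{v^1}\cup X^2_{v^2}$ and $X_v=X^i_v$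 for $v\in V(D^i)\setminus\{v^i\}$, $i\in\{1,2\}$. -}

module Defs where

open import Data.Nat using (ℕ; _≟_; _≤_)
open import Data.Bool using (if_then_else_)
open import Data.Product using (_×_; _,_; proj₁; proj₂; Σ; ∃)
open import Data.Product.Properties using (≡-dec)
open import Data.Unit using (⊤)
open import Data.List using (List; []; _∷_; _++_; length; filter; map)
open import Data.List.Membership.Propositional using (_∈_; _∉_)
open import Data.List.Membership.DecPropositional _≟_ using (_∈?_)
open import Data.List.Relation.Unary.Unique.Propositional using (Unique)
open import Data.List.Relation.Binary.Disjoint.Propositional using (Disjoint)
open import Relation.Nullary using (¬_; does; ¬?)
open import Relation.Nullary.Decidable using (_×-dec_)
open import Relation.Binary.PropositionalEquality using (_≡_; _≢_)

-- Vertices (of D and of H) are labelled by natural numbers; a finite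
-- digraph is a duplicate-free list of vertices and a list of arcs.
record Digraph : Set where
  constructor mkDigraph
  field
    V : List ℕ
    A : List (ℕ × ℕ)
open Digraph public

-- well-formed digraph: finite, no loops, no parallel arcs
-- (opposite arcs allowed), arcs join vertices of the digraph
record IsDigraph (D : Digraph) : Set where
  field
    V-unique   : Unique (V D)
    A-unique   : Unique (A D)
    A-ends     : ∀ u v → (u , v) ∈ A D → u ∈ V D × v ∈ V D
    no-loops   : ∀ u v → (u , v) ∈ A D → u ≢ v

data Reach (D : Digraph) : ℕ → ℕ → Set where
  here : ∀ {u} → Reach D u u
  fwd  : ∀ {u w v} → (u , w) ∈ A D → Reach D w v → Reach D u v
  bwd  : ∀ {u w v} → (w , u) ∈ A D → Reach D w v → Reach D u v

Connected : Digraph → Set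
Connected D = ∀ u v → u ∈ V D → v ∈ V D → Reach D u v

outdeg indeg : Digraph → ℕ → ℕ
outdeg D v = length (filter (λ a → proj₁ a ≟ v) (A D))
indeg  D v = length (filter (λ a → proj₂ a ≟ v) (A D))

record IsCover (D : Digraph) (X : ℕ → List ℕ) (H : Digraph) : Set where
  field
    X-unique   : ∀ v → v ∈ V D → Unique (X v)
    X-disjoint : ∀ u v → u ∈ V D → v ∈ V D → u ≢ v → Disjoint (X u) (X v)
    VH-sub     : ∀ x → x ∈ V H → ∃ λ v → v ∈ V D × x ∈ X v
    VH-sup     : ∀ v x → v ∈ V D → x ∈ X v → x ∈ V H
    X-indep    : ∀ v x y → v ∈ V D → (x , y) ∈ A H → ¬ (x ∈ X v × y ∈ X v)
    arises     : ∀ x y → (x , y) ∈ A H →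
                 ∃ λ u → ∃ λ v → (u , v) ∈ A D × x ∈ X u × y ∈ X v
    matching   : ∀ u v → (u , v) ∈ A D → ∀ x y x' y' →
                 (x , y) ∈ A H → (x' , y') ∈ A H →
                 x ∈ X u → y ∈ X v → x' ∈ X u → y' ∈ X v →
                 (x ≡ x' → y ≡ y') × (y ≡ y' → x ≡ x')

record Feasible (D : Digraph) (X : ℕ → List ℕ) (H : Digraph) : Set where
  field
    D-digraph : IsDigraph D
    H-digraph : IsDigraph H
    connected : Connected D
    cover     : IsCover D X H

DegreeFeasible : Digraph → (ℕ → List ℕ) → Set
DegreeFeasible D X = ∀ v → v ∈ V D → (outdeg D v ≤ length (X v)) × (indeg D v ≤ length (X v))

Chain : List (ℕ × ℕ) → List ℕ → Set
Chain As []           = ⊤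
Chain As (x ∷ [])     = ⊤
Chain As (x ∷ y ∷ r)  = (x , y) ∈ As × Chain As (y ∷ r)

-- no directed cycle: no sequence of distinct vertices x, x1, ..., xk
-- with arcs x→x1→...→xk→x
Acyclic : List (ℕ × ℕ) → Set
Acyclic As = ∀ x xs → Unique (x ∷ xs) → ¬ Chain As (x ∷ xs ++ x ∷ [])

induced : Digraph → List ℕ → List (ℕ × ℕ)
induced H T = filter (λ a → (proj₁ a ∈? T) ×-dec (proj₂ a ∈? T)) (A H)

Colorable : Digraph → (ℕ → List ℕ) → Digraph → Set
Colorable D X H = Σ (List ℕ) λ T →
  Unique T × (∀ x → x ∈ T → x ∈ V H) ×
  (∀ v → v ∈ V D → length (filter (λ x → x ∈? X v) T) ≡ 1) ×
  Acyclic (induced H T)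

deleteArc : Digraph → ℕ × ℕ → Digraph
deleteArc H a = mkDigraph (V H) (filter (λ b → ¬? (≡-dec _≟_ _≟_ b a)) (A H))

MinimalUncolorable : Digraph → (ℕ → List ℕ) → Digraph → Set
MinimalUncolorable D X H =
  ¬ Colorable D X H × (∀ a → a ∈ A H → Colorable D X (deleteArc H a))

MUDF : Digraph → (ℕ → List ℕ) → Digraph → Set
MUDF D X H = Feasible D X H × DegreeFeasible D X × MinimalUncolorable D X H

rename : ℕ → ℕ → ℕ → ℕ
rename old new x = if does (x ≟ old) then new else x

mergeD : Digraph → Digraph → ℕ → ℕ → ℕ → Digraph
mergeD D1 D2 v1 v2 w = mkDigraph
  (w ∷ filter (λ x → ¬? (x ≟ v1)) (V D1) ++ filter (λ x → ¬? (x ≟ v2)) (V D2))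
  (map (λ a → rename v1 w (proj₁ a) , rename v1 w (proj₂ a)) (A D1) ++
   map (λ a → rename v2 w (proj₁ a) , rename v2 w (proj₂ a)) (A D2))

mergeX : Digraph → (ℕ → List ℕ) → (ℕ → List ℕ) → ℕ → ℕ → ℕ → ℕ → List ℕ
mergeX D1 X1 X2 v1 v2 w v =
  if does (v ≟ w) then X1 v1 ++ X2 v2
  else (if does (v ∈? V D1) then X1 v else X2 v)

mergeH : Digraph → Digraph → Digraph
mergeH H1 H2 = mkDigraph (V H1 ++ V H2) (A H1 ++ A H2)

module Submission where

-- Feasibility of the merged configuration (M , XM , HM) is a matter of
-- bookkeeping: renaming v1 and v2 to w is injective on each side, the two
-- sides only meet in w, and every cover axiom is inherited from the side
-- owning the colours involved.  The equivalence rests on two facts: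
--   * Gluing and splitting: since H1 and H2 are vertex-disjoint, colourings of
--     M correspond to pairs of acyclic transversals of the two sides of which
--     exactly one colours the merge vertex (lemmas glue and split).
--   * Greedy colouring (module Greedy, a Gallai-type argument): in a connected
--     feasible configuration with enough colours at every vertex but v, all
--     vertices but v can be coloured acyclically; if v has slack in- or
--     out-degree, v can be coloured as well.

open import Defs
open import Level using (0ℓ)
open import Function using (_∘_; id)
open import Function.Bundles using (_⇔_; mk⇔)
open import Data.Bool using (true; false; if_then_else_)
open import Data.Empty using (⊥-elim)
open import Data.Unit using (tt)
open import Data.Nat using (ℕ; zero; suc; _+_; _≤_; _<_; z≤n; s≤s; _≟_)
open import Data.Nat.Properties
  using (≤-trans; n≤1+n; +-suc; <⇒≱; ≤-pred; <-≤-trans; ≤-<-trans; +-identityʳ; +-comm;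
         +-mono-≤; +-mono-<-≤; ≤⇒≯; ≰⇒>; ≮⇒≥; _<?_; _≤?_)
open import Data.Product as Product using (_×_; _,_; proj₁; proj₂; Σ; swap)
open import Data.Product.Properties using (≡-dec)
open import Data.Sum as Sum using (_⊎_; inj₁; inj₂; [_,_]′)
open import Data.List using (List; []; _∷_; _++_; length; filter; map)
open import Data.List.Properties
  using (length-++; filter-++; filter-none; filter-some; filter-accept; filter-reject;
         filter-notAll; length-filter; filter-all)
open import Data.List.Relation.Unary.Any using (here; there; any?)
open import Data.List.Relation.Unary.All as All using ([]; _∷_; tabulate; all?)
open import Data.List.Relation.Unary.All.Properties.Core using (¬Any⇒All¬; ¬All⇒Any¬)
open import Data.List.Relation.Unary.AllPairs using ([]; _∷_)
open import Data.List.Relation.Unary.Unique.Propositional using (Unique)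
open import Data.List.Relation.Unary.Unique.Propositional.Properties using (filter⁺; ++⁺)
open import Data.List.Relation.Binary.Disjoint.Propositional using (Disjoint)
open import Data.List.Membership.Propositional using (_∈_; _∉_; find; lose)
open import Data.List.Membership.Propositional.Properties
  using (∈-++⁺ˡ; ∈-++⁺ʳ; ∈-++⁻; ∈-filter⁺; ∈-filter⁻; ∈-map⁺; ∈-map⁻)
open import Data.List.Membership.DecPropositional _≟_ using (_∈?_)
open import Data.List.Membership.DecPropositional (≡-dec _≟_ _≟_) using () renaming (_∈?_ to _∈²?_)
open import Relation.Nullary using (¬_; yes; no; does; ¬?)
open import Relation.Nullary.Decidable using (_×-dec_; dec-true; dec-false)
open import Relation.Unary using (Pred; Decidable)
open import Relation.Binary.PropositionalEquality
  using (_≡_; _≢_; refl; sym; trans; cong; cong₂; subst; subst₂; module ≡-Reasoning)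

slack-transfer : ∀ {a b c d} → a + b ≤ c + d → ¬ a ≤ c → b < d
slack-transfer {a} {b} {c} {d} fits a≰c with b <? d
... | yes b<d = b<d
... | no b≮d  = ⊥-elim (≤⇒≯ fits (+-mono-<-≤ (≰⇒> a≰c) (≮⇒≥ b≮d)))

one-of : ∀ a b → a + b ≡ 1 → a ≡ 1 ⊎ b ≡ 1
one-of zero          b e = inj₂ e
one-of (suc zero)    b e = inj₁ refl
one-of (suc (suc a)) b ()

no-second : ∀ {n} → 1 ≤ n → suc n ≢ 1
no-second (s≤s z≤n) ()

count : {A : Set} {P : Pred A 0ℓ} → Decidable P → List A → ℕ
count P? L = length (filter P? L)

module _ {A : Set} where

  count-cong : {P Q : Pred A 0ℓ} (P? : Decidable P) (Q? : Decidable Q) (L : List A) →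
    (∀ x → x ∈ L → P x → Q x) → (∀ x → x ∈ L → Q x → P x) → count P? L ≡ count Q? L
  count-cong P? Q? [] f g = refl
  count-cong P? Q? (x ∷ L) f g with P? x | Q? x
  ... | yes p | yes q = cong suc (count-cong P? Q? L (λ y m → f y (there m)) (λ y m → g y (there m)))
  ... | yes p | no ¬q = ⊥-elim (¬q (f x (here refl) p))
  ... | no ¬p | yes q = ⊥-elim (¬p (g x (here refl) q))
  ... | no ¬p | no ¬q = count-cong P? Q? L (λ y m → f y (there m)) (λ y m → g y (there m))

  count-mono : {P Q : Pred A 0ℓ} (P? : Decidable P) (Q? : Decidable Q) (L : List A) →
    (∀ x → x ∈ L → P x → Q x) → count P? L ≤ count Q? L
  count-mono P? Q? [] f = z≤n
  count-mono P? Q? (x ∷ L) f with P? x | Q? x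
  ... | yes p | yes q = s≤s (count-mono P? Q? L (λ y m → f y (there m)))
  ... | yes p | no ¬q = ⊥-elim (¬q (f x (here refl) p))
  ... | no ¬p | yes q = ≤-trans (count-mono P? Q? L (λ y m → f y (there m))) (n≤1+n _)
  ... | no ¬p | no ¬q = count-mono P? Q? L (λ y m → f y (there m))

  count-< : {P Q : Pred A 0ℓ} (P? : Decidable P) (Q? : Decidable Q) (L : List A) →
    (∀ x → x ∈ L → P x → Q x) → (a : A) → a ∈ L → Q a → ¬ P a → count P? L < count Q? L
  count-< P? Q? (x ∷ L) f a (here refl) qa ¬pa with P? x | Q? x
  ... | yes p | _     = ⊥-elim (¬pa p)
  ... | no ¬p | yes q = s≤s (count-mono P? Q? L (λ y m → f y (there m)))
  ... | no ¬p | no ¬q = ⊥-elim (¬q qa)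
  count-< P? Q? (x ∷ L) f a (there m) qa ¬pa with P? x | Q? x
  ... | yes p | yes q = s≤s (count-< P? Q? L (λ y m → f y (there m)) a m qa ¬pa)
  ... | yes p | no ¬q = ⊥-elim (¬q (f x (here refl) p))
  ... | no ¬p | yes q = ≤-trans (count-< P? Q? L (λ y m → f y (there m)) a m qa ¬pa) (n≤1+n _)
  ... | no ¬p | no ¬q = count-< P? Q? L (λ y m → f y (there m)) a m qa ¬pa

  count-zero : {P : Pred A 0ℓ} (P? : Decidable P) (L : List A) →
    (∀ x → x ∈ L → ¬ P x) → count P? L ≡ 0
  count-zero P? L none = cong length (filter-none P? (tabulate (none _)))

  count-pos : {P : Pred A 0ℓ} (P? : Decidable P) (L : List A) (a : A) → a ∈ L → P a →
    1 ≤ count P? L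
  count-pos P? L a a∈ pa = filter-some P? (lose a∈ pa)

  count-++ : {P : Pred A 0ℓ} (P? : Decidable P) (L₁ L₂ : List A) →
    count P? (L₁ ++ L₂) ≡ count P? L₁ + count P? L₂
  count-++ P? L₁ L₂ = trans (cong length (filter-++ P? L₁ L₂)) (length-++ (filter P? L₁))

  count-one : {P : Pred A 0ℓ} (P? : Decidable P) (L : List A) → count P? L ≡ 1 →
    (a b : A) → a ∈ L → P a → b ∈ L → P b → a ≡ b
  count-one P? (x ∷ L) eq a b a∈ pa b∈ pb with P? x
  count-one P? (x ∷ L) eq a b (here refl) pa (here refl) pb | yes _ = refl
  count-one P? (x ∷ L) eq a b (here refl) pa (there b∈) pb | yes _ =
    ⊥-elim (no-second (count-pos P? L b b∈ pb) eq)
  count-one P? (x ∷ L) eq a b (there a∈) pa _ pb | yes _ =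
    ⊥-elim (no-second (count-pos P? L a a∈ pa) eq)
  count-one P? (x ∷ L) eq a b (here refl) pa b∈ pb | no ¬p = ⊥-elim (¬p pa)
  count-one P? (x ∷ L) eq a b (there a∈) pa (here refl) pb | no ¬p = ⊥-elim (¬p pb)
  count-one P? (x ∷ L) eq a b (there a∈) pa (there b∈) pb | no ¬p = count-one P? L eq a b a∈ pa b∈ pb

  count-map : {B : Set} {P : Pred B 0ℓ} (P? : Decidable P) (f : A → B) (L : List A) →
    count P? (map f L) ≡ count (λ a → P? (f a)) L
  count-map P? f [] = refl
  count-map P? f (x ∷ L) with does (P? (f x))
  ... | true  = cong suc (count-map P? f L)
  ... | false = count-map P? f L

hits : List ℕ → List ℕ → ℕ
hits S L = count (_∈? S) L

hits-∷-∈ : (S L : List ℕ) (x : ℕ) → x ∈ S → hits S (x ∷ L) ≡ suc (hits S L)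
hits-∷-∈ S L x x∈ = cong length (filter-accept (_∈? S) x∈)

hits-∷-∉ : (S L : List ℕ) (x : ℕ) → x ∉ S → hits S (x ∷ L) ≡ hits S L
hits-∷-∉ S L x x∉ = cong length (filter-reject (_∈? S) x∉)

hits-disjoint-++ : (S₁ S₂ L : List ℕ) → Disjoint S₁ S₂ → hits (S₁ ++ S₂) L ≡ hits S₁ L + hits S₂ L
hits-disjoint-++ S₁ S₂ [] dj = refl
hits-disjoint-++ S₁ S₂ (x ∷ L) dj with x ∈? S₁ | x ∈? S₂
... | yes x₁ | yes x₂ = ⊥-elim (dj (x₁ , x₂))
... | yes x₁ | no _   = trans (hits-∷-∈ (S₁ ++ S₂) L x (∈-++⁺ˡ x₁)) (cong suc (hits-disjoint-++ S₁ S₂ L dj))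
... | no _   | yes x₂ = trans (hits-∷-∈ (S₁ ++ S₂) L x (∈-++⁺ʳ S₁ x₂))
                          (trans (cong suc (hits-disjoint-++ S₁ S₂ L dj)) (sym (+-suc (hits S₁ L) (hits S₂ L))))
... | no x₁  | no x₂  = trans (hits-∷-∉ (S₁ ++ S₂) L x (λ m → [ x₁ , x₂ ]′ (∈-++⁻ S₁ m)))
                          (hits-disjoint-++ S₁ S₂ L dj)

hits-filter : (S S' L : List ℕ) → (∀ x → x ∈ S → x ∈ S') → hits S (filter (_∈? S') L) ≡ hits S L
hits-filter S S' [] sub = refl
hits-filter S S' (x ∷ L) sub with x ∈? S'
... | no x∉S' = trans (hits-filter S S' L sub) (sym (hits-∷-∉ S L x (λ x∈S → x∉S' (sub x x∈S))))
... | yes _ with x ∈? S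
...   | yes _ = cong suc (hits-filter S S' L sub)
...   | no _  = hits-filter S S' L sub

module _ {C : Set} where

  remove : {c : C} (xs : List C) → c ∈ xs → List C
  remove (x ∷ xs) (here _)  = xs
  remove (x ∷ xs) (there p) = x ∷ remove xs p

  remove-length : {c : C} (xs : List C) (p : c ∈ xs) → suc (length (remove xs p)) ≡ length xs
  remove-length (x ∷ xs) (here _)  = refl
  remove-length (x ∷ xs) (there p) = cong suc (remove-length xs p)

  remove-keeps : {c y : C} (xs : List C) (p : c ∈ xs) → y ∈ xs → y ≢ c → y ∈ remove xs p
  remove-keeps (x ∷ xs) (here refl) (here refl) y≢c = ⊥-elim (y≢c refl)
  remove-keeps (x ∷ xs) (here refl) (there q)   y≢c = q
  remove-keeps (x ∷ xs) (there p)   (here refl) y≢c = here refl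
  remove-keeps (x ∷ xs) (there p)   (there q)   y≢c = there (remove-keeps xs p q y≢c)

  pigeonhole : (R : ℕ → C → Set) (B : List ℕ) (L : List C) → Unique B →
    (∀ x → x ∈ B → Σ C λ c → c ∈ L × R x c) →
    (∀ x x' c → R x c → R x' c → x ≡ x') →
    length B ≤ length L
  pigeonhole R [] L _ _ _ = z≤n
  pigeonhole R (b ∷ B) L (b∉B ∷ uB) related functional with related b (here refl)
  ... | c , c∈L , Rbc =
    subst (suc (length B) ≤_) (remove-length L c∈L)
      (s≤s (pigeonhole R B (remove L c∈L) uB related' functional))
    where
    related' : ∀ x → x ∈ B → Σ C λ c' → c' ∈ remove L c∈L × R x c'
    related' x x∈B with related x (there x∈B)
    ... | c' , c'∈L , Rxc' =
      c' , remove-keeps L c∈L c'∈L (λ { refl → All.lookup b∉B x∈B (functional b x c Rbc Rxc') }) , Rxc'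

chain-mono : {As Bs : List (ℕ × ℕ)} (L : List ℕ) →
  (∀ a b → a ∈ L → b ∈ L → (a , b) ∈ As → (a , b) ∈ Bs) → Chain As L → Chain Bs L
chain-mono []          f c       = tt
chain-mono (x ∷ [])    f c       = tt
chain-mono (x ∷ y ∷ L) f (p , c) =
  f x y (here refl) (there (here refl)) p ,
  chain-mono (y ∷ L) (λ a b a∈ b∈ → f a b (there a∈) (there b∈)) c

chain-inv : {As Bs : List (ℕ × ℕ)} (S : ℕ → Set) →
  (∀ a b → (a , b) ∈ As → S a → (a , b) ∈ Bs × S b) →
  (a : ℕ) (L : List ℕ) → S a → Chain As (a ∷ L) → Chain Bs (a ∷ L)
chain-inv S f a []      s c       = tt
chain-inv S f a (b ∷ L) s (p , c) with f a b p s
... | q , sb = q , chain-inv S f b L sb c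

chain-tail : {As : List (ℕ × ℕ)} (x : ℕ) (M : List ℕ) → Chain As (x ∷ M) → Chain As M
chain-tail x []      _       = tt
chain-tail x (y ∷ M) (_ , c) = c

chain-pred : {As : List (ℕ × ℕ)} (a : ℕ) (L : List ℕ) → Chain As (a ∷ L) →
  ∀ y → y ∈ L → Σ ℕ λ p → p ∈ a ∷ L × (p , y) ∈ As
chain-pred a (b ∷ L) (p , c) y (here refl) = a , here refl , p
chain-pred a (b ∷ L) (p , c) y (there y∈) with chain-pred b L c y y∈
... | q , q∈ , r = q , there q∈ , r

chain-succ : {As : List (ℕ × ℕ)} (L : List ℕ) (b : ℕ) → Chain As (L ++ b ∷ []) →
  ∀ y → y ∈ L → Σ ℕ λ s → s ∈ L ++ b ∷ [] × (y , s) ∈ As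
chain-succ (x ∷ [])     b (p , _) y (here refl) = b , there (here refl) , p
chain-succ (x ∷ x' ∷ L) b (p , c) y (here refl) = x' , there (here refl) , p
chain-succ (x ∷ L)      b c       y (there y∈) with chain-succ L b (chain-tail x (L ++ b ∷ []) c) y y∈
... | s , s∈ , r = s , there s∈ , r

cycle-⊆ : (z : ℕ) (zs : List ℕ) {y : ℕ} → y ∈ z ∷ zs ++ z ∷ [] → y ∈ z ∷ zs
cycle-⊆ z zs (here refl) = here refl
cycle-⊆ z zs (there y∈) with ∈-++⁻ zs y∈
... | inj₁ q          = there q
... | inj₂ (here refl) = here refl

cycle-⊇ : (z : ℕ) (zs : List ℕ) {y : ℕ} → y ∈ z ∷ zs → y ∈ zs ++ z ∷ []
cycle-⊇ z zs (here refl) = ∈-++⁺ʳ zs (here refl)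
cycle-⊇ z zs (there y∈)  = ∈-++⁺ˡ y∈

cycle-pred : {As : List (ℕ × ℕ)} (z : ℕ) (zs : List ℕ) → Chain As (z ∷ zs ++ z ∷ []) →
  ∀ y → y ∈ z ∷ zs → Σ ℕ λ p → p ∈ z ∷ zs × (p , y) ∈ As
cycle-pred z zs c y y∈ with chain-pred z (zs ++ z ∷ []) c y (cycle-⊇ z zs y∈)
... | p , p∈ , r = p , cycle-⊆ z zs p∈ , r

cycle-succ : {As : List (ℕ × ℕ)} (z : ℕ) (zs : List ℕ) → Chain As (z ∷ zs ++ z ∷ []) →
  ∀ y → y ∈ z ∷ zs → Σ ℕ λ s → s ∈ z ∷ zs × (y , s) ∈ As
cycle-succ z zs c y y∈ with chain-succ (z ∷ zs) z c y y∈
... | s , s∈ , r = s , cycle-⊆ z zs s∈ , r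

induced⁻ : (H : Digraph) (T : List ℕ) {a b : ℕ} → (a , b) ∈ induced H T → (a , b) ∈ A H × a ∈ T × b ∈ T
induced⁻ H T m = ∈-filter⁻ (λ a → (proj₁ a ∈? T) ×-dec (proj₂ a ∈? T)) {xs = A H} m

induced⁺ : (H : Digraph) (T : List ℕ) {a b : ℕ} → (a , b) ∈ A H → a ∈ T → b ∈ T → (a , b) ∈ induced H T
induced⁺ H T ab a∈ b∈ = ∈-filter⁺ (λ a → (proj₁ a ∈? T) ×-dec (proj₂ a ∈? T)) ab (a∈ , b∈)

acyclic-mono : (As Bs : List (ℕ × ℕ)) → (∀ a b → (a , b) ∈ As → (a , b) ∈ Bs) → Acyclic Bs → Acyclic As
acyclic-mono As Bs sub acyclic z zs u c =
  acyclic z zs u (chain-mono (z ∷ zs ++ z ∷ []) (λ a b _ _ → sub a b) c)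

cycle-start : (H : Digraph) (T : List ℕ) (z : ℕ) (zs : List ℕ) →
  Chain (induced H T) (z ∷ zs ++ z ∷ []) → z ∈ T
cycle-start H T z []       (c , _) = proj₁ (proj₂ (induced⁻ H T c))
cycle-start H T z (y ∷ zs) (c , _) = proj₁ (proj₂ (induced⁻ H T c))

acyclic-[] : (H : Digraph) → Acyclic (induced H [])
acyclic-[] H z zs u c with cycle-start H [] z zs c
... | ()

-- Colouring a new vertex x next to already coloured vertices y only
-- interacts with the arcs between x and the y's in one direction: into x
-- (In) or out of x (Out).
data Dir : Set where
  In Out : Dir

toward : Dir → ℕ → ℕ → ℕ × ℕ
toward In  y x = y , x
toward Out y x = x , y

near far : Dir → ℕ × ℕ → ℕ
near In  = proj₂
near Out = proj₁
far In  = proj₁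
far Out = proj₂

near-toward : ∀ d y x → near d (toward d y x) ≡ x
near-toward In  y x = refl
near-toward Out y x = refl

far-toward : ∀ d y x → far d (toward d y x) ≡ y
far-toward In  y x = refl
far-toward Out y x = refl

toward-injective : ∀ d {y y' x} → toward d y x ≡ toward d y' x → y ≡ y'
toward-injective d {y} {y'} {x} e =
  trans (sym (far-toward d y x)) (trans (cong (far d) e) (far-toward d y' x))

near-∈ : {D : Digraph} → IsDigraph D → ∀ d {a} → a ∈ A D → near d a ∈ V D
near-∈ isD In  {p , q} arc = proj₂ (IsDigraph.A-ends isD p q arc)
near-∈ isD Out {p , q} arc = proj₁ (IsDigraph.A-ends isD p q arc)

degree : Dir → Digraph → ℕ → ℕ
degree d D v = count (λ a → near d a ≟ v) (A D)

degree-bound : (D : Digraph) (X : ℕ → List ℕ) → DegreeFeasible D X →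
  ∀ {v} → v ∈ V D → ∀ d → degree d D v ≤ length (X v)
degree-bound D X df v∈ In  = proj₂ (df _ v∈)
degree-bound D X df v∈ Out = proj₁ (df _ v∈)

degree-feasible : (D : Digraph) (X : ℕ → List ℕ) →
  (∀ v → v ∈ V D → ∀ d → degree d D v ≤ length (X v)) → DegreeFeasible D X
degree-feasible D X bound v v∈ = bound v v∈ Out , bound v v∈ In

cycle-neighbour : {As : List (ℕ × ℕ)} (d : Dir) (z : ℕ) (zs : List ℕ) →
  Chain As (z ∷ zs ++ z ∷ []) → ∀ x → x ∈ z ∷ zs → Σ ℕ λ y → toward d y x ∈ As
cycle-neighbour In  z zs c x x∈ with cycle-pred z zs c x x∈
... | y , _ , arc = y , arc
cycle-neighbour Out z zs c x x∈ with cycle-succ z zs c x x∈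
... | y , _ , arc = y , arc

induced-toward⁻ : (d : Dir) (H : Digraph) (T : List ℕ) {y x : ℕ} →
  toward d y x ∈ induced H T → toward d y x ∈ A H × y ∈ T
induced-toward⁻ In  H T arc with induced⁻ H T arc
... | ab , y∈ , _ = ab , y∈
induced-toward⁻ Out H T arc with induced⁻ H T arc
... | ab , _ , y∈ = ab , y∈

toward-loop : (d : Dir) (H : Digraph) → IsDigraph H → ∀ x → toward d x x ∉ A H
toward-loop In  H isH x arc = IsDigraph.no-loops isH x x arc refl
toward-loop Out H isH x arc = IsDigraph.no-loops isH x x arc refl

-- Adding to T a vertex x that has no arc in direction d to any vertex of T
-- creates no directed cycle: on a cycle, x would have such a neighbour.
acyclic-extend : (d : Dir) (H : Digraph) → IsDigraph H → (T : List ℕ) (x : ℕ) →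
  Acyclic (induced H T) → (∀ y → y ∈ T → toward d y x ∉ A H) → Acyclic (induced H (x ∷ T))
acyclic-extend d H isH T x acyclic free z zs u c with x ∈? (z ∷ zs)
... | yes x∈ with cycle-neighbour d z zs c x x∈
...   | y , arc with induced-toward⁻ d H (x ∷ T) arc
...     | yx , here refl = toward-loop d H isH x yx
...     | yx , there y∈T = free y y∈T yx
acyclic-extend d H isH T x acyclic free z zs u c | no x∉ =
  acyclic z zs u (chain-mono (z ∷ zs ++ z ∷ []) avoid-x c)
  where
  avoid-x : ∀ a b → a ∈ z ∷ zs ++ z ∷ [] → b ∈ z ∷ zs ++ z ∷ [] →
    (a , b) ∈ induced H (x ∷ T) → (a , b) ∈ induced H T
  avoid-x a b a∈ b∈ ab with induced⁻ H (x ∷ T) ab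
  ... | _   , here refl , _         = ⊥-elim (x∉ (cycle-⊆ z zs a∈))
  ... | _   , there _   , here refl = ⊥-elim (x∉ (cycle-⊆ z zs b∈))
  ... | arc , there a∈T , there b∈T = induced⁺ H T arc a∈T b∈T

without : ℕ → List ℕ → List ℕ
without u L = filter (λ x → ¬? (x ≟ u)) L

∈-without⁻ : (u : ℕ) (L : List ℕ) {x : ℕ} → x ∈ without u L → x ∈ L × x ≢ u
∈-without⁻ u L x∈ = ∈-filter⁻ (λ x → ¬? (x ≟ u)) {xs = L} x∈

∈-without⁺ : (u : ℕ) (L : List ℕ) {x : ℕ} → x ∈ L → x ≢ u → x ∈ without u L
∈-without⁺ u L x∈ x≢u = ∈-filter⁺ (λ x → ¬? (x ≟ u)) x∈ x≢u

u∉without : (u : ℕ) (L : List ℕ) → u ∉ without u L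
u∉without u L u∈ = proj₂ (∈-without⁻ u L u∈) refl

∈-without⁻ₗ : ∀ {u L x} → x ∈ without u L → x ∈ L
∈-without⁻ₗ {u} {L} x∈ = proj₁ (∈-without⁻ u L x∈)

without-shorter : ∀ {u L} → u ∈ L → length (without u L) < length L
without-shorter {u} {L} u∈ = filter-notAll (λ x → ¬? (x ≟ u)) L (lose u∈ λ ¬u≢u → ¬u≢u refl)

without-split : ∀ {u L y} → y ∈ L → y ∈ u ∷ without u L
without-split {u} {L} {y} y∈ with y ≟ u
... | yes refl = here refl
... | no y≢u   = there (∈-without⁺ u L y∈ y≢u)

without-restore : ∀ {u L y} → u ∈ L → y ∈ u ∷ without u L → y ∈ L
without-restore u∈ (here refl) = u∈
without-restore u∈ (there y∈)  = ∈-without⁻ₗ y∈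

deleteArc-⊆ : (H : Digraph) (a : ℕ × ℕ) → ∀ x y → (x , y) ∈ A (deleteArc H a) → (x , y) ∈ A H
deleteArc-⊆ H a x y xy = proj₁ (∈-filter⁻ (λ b → ¬? (≡-dec _≟_ _≟_ b a)) {xs = A H} xy)

deleteArc-mergeH : (H₁ H₂ : Digraph) (a : ℕ × ℕ) →
  deleteArc (mergeH H₁ H₂) a ≡ mergeH (deleteArc H₁ a) (deleteArc H₂ a)
deleteArc-mergeH H₁ H₂ a = cong (mkDigraph (V H₁ ++ V H₂)) (filter-++ (λ b → ¬? (≡-dec _≟_ _≟_ b a)) (A H₁) (A H₂))

deleteArc-absent : (H : Digraph) (a : ℕ × ℕ) → a ∉ A H → deleteArc H a ≡ H
deleteArc-absent H a a∉ = cong (mkDigraph (V H))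
  (filter-all (λ b → ¬? (≡-dec _≟_ _≟_ b a)) (tabulate λ { b∈ refl → a∉ b∈ }))

unique-map : {B C : Set} (f : B → C) (L : List B) →
  (∀ x y → x ∈ L → y ∈ L → f x ≡ f y → x ≡ y) → Unique L → Unique (map f L)
unique-map f []      inj []          = []
unique-map f (x ∷ L) inj (x∉L ∷ uL) =
  ¬Any⇒All¬ (map f L) fresh ∷ unique-map f L (λ a b a∈ b∈ → inj a b (there a∈) (there b∈)) uL
  where
  fresh : f x ∉ map f L
  fresh fx∈ with ∈-map⁻ f fx∈
  ... | y , y∈ , e = All.lookup x∉L y∈ (inj x y (here refl) (there y∈) e)

withArcs : Digraph → List (ℕ × ℕ) → Digraph
withArcs H As = mkDigraph (V H) As

record Transversal (D : Digraph) (X : ℕ → List ℕ) (H : Digraph) (v k : ℕ) (T : List ℕ) : Set where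
  field
    unique   : Unique T
    inside   : ∀ x → x ∈ T → x ∈ V H
    hits-off : ∀ u → u ∈ V D → u ≢ v → hits (X u) T ≡ 1
    hits-at  : hits (X v) T ≡ k
    acyclic  : Acyclic (induced H T)

colouring⇒transversal : {D H : Digraph} {X : ℕ → List ℕ} {v : ℕ} → v ∈ V D →
  (c : Colorable D X H) → Transversal D X H v 1 (proj₁ c)
colouring⇒transversal v∈ (T , unique , inside , hits-one , acyclic) = record
  { unique = unique ; inside = inside ; hits-off = λ u u∈ _ → hits-one u u∈
  ; hits-at = hits-one _ v∈ ; acyclic = acyclic }

transversal-mono : {D H : Digraph} {X : ℕ → List ℕ} {v k : ℕ} {T : List ℕ} (As : List (ℕ × ℕ)) →
  (∀ a b → (a , b) ∈ As → (a , b) ∈ A H) →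
  Transversal D X H v k T → Transversal D X (withArcs H As) v k T
transversal-mono {H = H} {T = T} As sub t = record
  { unique = unique ; inside = inside ; hits-off = hits-off ; hits-at = hits-at
  ; acyclic = acyclic-mono (induced (withArcs H As) T) (induced H T) keep acyclic }
  where
  open Transversal t
  keep : ∀ a b → (a , b) ∈ induced (withArcs H As) T → (a , b) ∈ induced H T
  keep a b ab with induced⁻ (withArcs H As) T ab
  ... | arc , a∈ , b∈ = induced⁺ H T (sub a b arc) a∈ b∈

-- In a feasible configuration whose colour lists are large enough at every
-- vertex except v, all vertices but v can be coloured acyclically: colour them
-- in an order in which every vertex has a neighbour coloured later (possible as
-- D is connected), and pick for each vertex a colour not joined, in the
-- direction of that later neighbour, to any colour already chosen.  Such a
-- colour exists since the cover arcs form matchings.  If v itself has slack,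
-- it can be coloured last in the same way.
module Greedy {D : Digraph} {X : ℕ → List ℕ} {H : Digraph} (F : Feasible D X H) where
  open Feasible F
  open IsCover cover

  owner-unique : ∀ {u u' x} → u ∈ V D → u' ∈ V D → x ∈ X u → x ∈ X u' → u ≡ u'
  owner-unique {u} {u'} u∈ u'∈ x∈ x∈' with u ≟ u'
  ... | yes e   = e
  ... | no u≢u' = ⊥-elim (X-disjoint _ _ u∈ u'∈ u≢u' (x∈ , x∈'))

  record Partial (R T : List ℕ) : Set where
    field
      unique  : Unique T
      inside  : ∀ x → x ∈ T → x ∈ V H
      one     : ∀ v → v ∈ V D → v ∈ R → hits (X v) T ≡ 1
      none    : ∀ v → v ∈ V D → v ∉ R → hits (X v) T ≡ 0
      acyclic : Acyclic (induced H T)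

  partial-resp : ∀ {R R' T} → (∀ {y} → y ∈ R → y ∈ R') → (∀ {y} → y ∈ R' → y ∈ R) →
    Partial R T → Partial R' T
  partial-resp R⊆R' R'⊆R p = record
    { unique = unique ; inside = inside ; acyclic = acyclic
    ; one  = λ y y∈ y∈R' → one y y∈ (R'⊆R y∈R')
    ; none = λ y y∈ y∉R' → none y y∈ (y∉R' ∘ R⊆R') }
    where open Partial p

  uncoloured : ∀ {R T v y} → Partial R T → v ∈ V D → v ∉ R → y ∈ T → y ∉ X v
  uncoloured {R} {T} {v} {y} p v∈ v∉ y∈T y∈X
    with subst (1 ≤_) (Partial.none p v v∈ v∉) (count-pos (_∈? X v) T y y∈T y∈X)
  ... | ()

  arcsFrom : Dir → List ℕ → ℕ → List (ℕ × ℕ)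
  arcsFrom d R u = filter (λ a → (far d a ∈? R) ×-dec (near d a ≟ u)) (A D)

  arcsFrom-∈ : ∀ d {R p u} → toward d p u ∈ A D → p ∈ R → toward d p u ∈ arcsFrom d R u
  arcsFrom-∈ d {R} {p} {u} arc p∈ = ∈-filter⁺ (λ a → (far d a ∈? R) ×-dec (near d a ≟ u)) arc
    (subst (_∈ R) (sym (far-toward d p u)) p∈ , near-toward d p u)

  arcsFrom-< : ∀ d {R z u} → toward d z u ∈ A D → z ∉ R → length (arcsFrom d R u) < degree d D u
  arcsFrom-< d {R} {z} {u} arc z∉ =
    count-< (λ a → (far d a ∈? R) ×-dec (near d a ≟ u)) (λ a → near d a ≟ u) (A D) (λ _ _ → proj₂)
      (toward d z u) arc (near-toward d z u) (λ p → z∉ (subst (_∈ R) (far-toward d z u) (proj₁ p)))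

  arcsFrom-≤ : ∀ d R u → length (arcsFrom d R u) ≤ degree d D u
  arcsFrom-≤ d R u =
    count-mono (λ a → (far d a ∈? R) ×-dec (near d a ≟ u)) (λ a → near d a ≟ u) (A D) (λ _ _ → proj₂)

  arises-toward : ∀ d {y x} → toward d y x ∈ A H →
    Σ ℕ λ p → Σ ℕ λ q → toward d p q ∈ A D × y ∈ X p × x ∈ X q
  arises-toward In  arc with arises _ _ arc
  ... | p , q , pq , y∈ , x∈ = p , q , pq , y∈ , x∈
  arises-toward Out arc with arises _ _ arc
  ... | q , p , qp , x∈ , y∈ = p , q , qp , y∈ , x∈

  matching-toward : ∀ d {p q} → toward d p q ∈ A D → ∀ {y x y' x'} →
    toward d y x ∈ A H → toward d y' x' ∈ A H →
    y ∈ X p → x ∈ X q → y' ∈ X p → x' ∈ X q → y ≡ y' → x ≡ x'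
  matching-toward In  pq yx y'x' y∈ x∈ y'∈ x'∈ = proj₁ (matching _ _ pq _ _ _ _ yx y'x' y∈ x∈ y'∈ x'∈)
  matching-toward Out qp xy x'y' y∈ x∈ y'∈ x'∈ = proj₂ (matching _ _ qp _ _ _ _ xy x'y' x∈ y∈ x'∈ y'∈)

  ends-toward : ∀ d {p q} → toward d p q ∈ A D → p ∈ V D × q ∈ V D
  ends-toward In  arc = IsDigraph.A-ends D-digraph _ _ arc
  ends-toward Out arc = swap (IsDigraph.A-ends D-digraph _ _ arc)

  extend-with : ∀ {R T u x} → Partial R T → u ∈ V D → u ∉ R → x ∈ X u →
    Acyclic (induced H (x ∷ T)) → Partial (u ∷ R) (x ∷ T)
  extend-with {R} {T} {u} {x} p u∈ u∉ x∈ acyclic' = record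
    { unique  = tabulate (λ { x∈T refl → uncoloured p u∈ u∉ x∈T x∈ }) ∷ unique
    ; inside  = λ { y (here refl) → VH-sup u x u∈ x∈ ; y (there y∈) → inside y y∈ }
    ; one     = one'
    ; none    = none'
    ; acyclic = acyclic' }
    where
    open Partial p
    one' : ∀ v → v ∈ V D → v ∈ u ∷ R → hits (X v) (x ∷ T) ≡ 1
    one' v v∈ (here refl) = trans (hits-∷-∈ (X u) T x x∈) (cong suc (none u u∈ u∉))
    one' v v∈ (there v∈R) = trans (hits-∷-∉ (X v) T x
      (λ x∈' → u∉ (subst (_∈ R) (owner-unique v∈ u∈ x∈' x∈) v∈R))) (one v v∈ v∈R)
    none' : ∀ v → v ∈ V D → v ∉ u ∷ R → hits (X v) (x ∷ T) ≡ 0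
    none' v v∈ v∉ = trans (hits-∷-∉ (X v) T x (λ x∈' → v∉ (here (owner-unique v∈ u∈ x∈' x∈))))
      (none v v∈ (λ v∈R → v∉ (there v∈R)))

  -- If every colour x of u is blocked by some y ∈ T joined to it in direction d,
  -- then y lies over an arc from R to u, and distinct x's use distinct arcs.
  blocked-bound : ∀ d {R T u} → Partial R T → u ∈ V D →
    (∀ x → x ∈ X u → Σ ℕ λ y → y ∈ T × toward d y x ∈ A H) →
    length (X u) ≤ length (arcsFrom d R u)
  blocked-bound d {R} {T} {u} p u∈ blocked = pigeonhole Blocks (X u) (arcsFrom d R u) (X-unique u u∈) block functional
    where
    open Partial p
    Blocks : ℕ → ℕ × ℕ → Set
    Blocks x c = Σ ℕ λ q → c ≡ toward d q u × q ∈ R × c ∈ A D × x ∈ X u ×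
                 Σ ℕ λ y → y ∈ T × y ∈ X q × toward d y x ∈ A H
    block : ∀ x → x ∈ X u → Σ (ℕ × ℕ) λ c → c ∈ arcsFrom d R u × Blocks x c
    block x x∈ with blocked x x∈
    ... | y , y∈T , yx with arises-toward d yx
    ...   | q , u' , qu' , y∈ , x∈' with owner-unique (proj₂ (ends-toward d qu')) u∈ x∈' x∈
    ...     | refl with q ∈? R
    ...       | yes q∈R = toward d q u , arcsFrom-∈ d qu' q∈R , q , refl , q∈R , qu' , x∈ , y , y∈T , y∈ , yx
    ...       | no q∉R  = ⊥-elim (uncoloured p (proj₁ (ends-toward d qu')) q∉R y∈T y∈)
    -- colours blocked via the same arc have the same blocker (T colours q once),
    -- hence coincide as the arcs over that arc form a matching
    functional : ∀ x x' c → Blocks x c → Blocks x' c → x ≡ x'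
    functional x x' c (q , refl , q∈R , qu , x∈ , y , y∈T , y∈ , yx) (q' , e , _ , _ , x'∈ , y' , y'∈T , y'∈ , y'x')
      with toward-injective d e
    ... | refl = matching-toward d qu yx y'x' y∈ x∈ y'∈ x'∈
                   (count-one (_∈? X q) T (one q (proj₁ (ends-toward d qu)) q∈R) y y' y∈T y∈ y'∈T y'∈)

  extend : ∀ d {R T u} → Partial R T → u ∈ V D → u ∉ R → length (arcsFrom d R u) < length (X u) →
    Σ ℕ λ x → Partial (u ∷ R) (x ∷ T)
  extend d {R} {T} {u} p u∈ u∉ few with all? (λ x → any? (λ y → toward d y x ∈²? A H) T) (X u)
  ... | yes all-blocked =
    ⊥-elim (<⇒≱ few (blocked-bound d p u∈ (λ x x∈ → find (All.lookup all-blocked x∈))))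
  ... | no some-free with find (¬All⇒Any¬ (λ x → any? (λ y → toward d y x ∈²? A H) T) (X u) some-free)
  ...   | x , x∈ , free =
    x , extend-with p u∈ u∉ x∈
          (acyclic-extend d H H-digraph T x (Partial.acyclic p) (λ y y∈T yx → free (lose y∈T yx)))

  boundary : ∀ {a b} (R : List ℕ) → Reach D a b → a ∈ R → b ∉ R →
    Σ ℕ λ u → Σ ℕ λ z → Σ Dir λ d → u ∈ R × z ∉ R × toward d z u ∈ A D
  boundary R here a∈ b∉ = ⊥-elim (b∉ a∈)
  boundary R (fwd {u} {z} arc walk) u∈ b∉ with z ∈? R
  ... | yes z∈ = boundary R walk z∈ b∉
  ... | no z∉  = u , z , Out , u∈ , z∉ , arc
  boundary R (bwd {u} {z} arc walk) u∈ b∉ with z ∈? R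
  ... | yes z∈ = boundary R walk z∈ b∉
  ... | no z∉  = u , z , In , u∈ , z∉ , arc

  module _ (v : ℕ) (v∈ : v ∈ V D)
           (room : ∀ u → u ∈ V D → u ≢ v → ∀ d → degree d D u ≤ length (X u)) where

    -- Any set R of vertices avoiding v can be coloured: the last vertex u of R on
    -- a walk towards v has a neighbour outside R, hence slack towards R ∖ u.
    colour : (n : ℕ) (R : List ℕ) → length R ≤ n → (∀ x → x ∈ R → x ∈ V D) → v ∉ R → Σ (List ℕ) (Partial R)
    colour n [] _ _ _ = [] , record
      { unique = [] ; inside = λ _ () ; one = λ _ _ () ; none = λ _ _ _ → refl ; acyclic = acyclic-[] H }
    colour (suc n) R@(r ∷ _) (s≤s len) R⊆ v∉
      with boundary R (connected r v (R⊆ r (here refl)) v∈) (here refl) v∉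
    ... | u , z , d , u∈R , z∉R , zu
      with colour n (without u R) (≤-pred (<-≤-trans (without-shorter u∈R) (s≤s len)))
                  (λ x x∈ → R⊆ x (∈-without⁻ₗ x∈)) (v∉ ∘ ∈-without⁻ₗ)
    ...   | T , p with extend d p (R⊆ u u∈R) (u∉without u R)
                           (<-≤-trans (arcsFrom-< d zu (z∉R ∘ ∈-without⁻ₗ))
                                      (room u (R⊆ u u∈R) (λ { refl → v∉ u∈R }) d))
    ...     | x , p' = x ∷ T , partial-resp (without-restore u∈R) without-split p'

    colour-others : Σ (List ℕ) (Partial (without v (V D)))
    colour-others = colour (length (V D)) (without v (V D)) (length-filter (λ x → ¬? (x ≟ v)) (V D))
                      (λ x → ∈-without⁻ₗ) (u∉without v (V D))

    transversal-but : Σ (List ℕ) (Transversal D X H v 0)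
    transversal-but with colour-others
    ... | T , p = T , record
      { unique = unique ; inside = inside ; acyclic = acyclic
      ; hits-off = λ u u∈ u≢v → one u u∈ (∈-without⁺ v (V D) u∈ u≢v)
      ; hits-at = none v v∈ (u∉without v (V D)) }
      where open Partial p

    colourable-by-slack : ∀ d → degree d D v < length (X v) → Colorable D X H
    colourable-by-slack d slack with colour-others
    ... | T , p with extend d p v∈ (u∉without v (V D)) (≤-<-trans (arcsFrom-≤ d _ v) slack)
    ...   | x , p' = x ∷ T , unique , inside , (λ u u∈ → one u u∈ (without-split u∈)) , acyclic
      where open Partial p'

ArcsWithin : Digraph → Set
ArcsWithin H = ∀ a b → (a , b) ∈ A H → a ∈ V H × b ∈ V H

cycle-confined : (G K L : Digraph) → ArcsWithin K → ArcsWithin L → Disjoint (V K) (V L) →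
  (T TK TL : List ℕ) → (∀ {a} → a ∈ A G → a ∈ A K ⊎ a ∈ A L) → (∀ {x} → x ∈ T → x ∈ TK ⊎ x ∈ TL) →
  (∀ x → x ∈ TL → x ∈ V L) → Acyclic (induced K TK) →
  ∀ z zs → Unique (z ∷ zs) → z ∈ V K → ¬ Chain (induced G T) (z ∷ zs ++ z ∷ [])
cycle-confined G K L withinK withinL disjoint T TK TL G⊆ T⊆ TL⊆ acyclic z zs u z∈ c =
  acyclic z zs u (chain-inv (_∈ V K) stay z (zs ++ z ∷ []) z∈ c)
  where
  onlyK : ∀ {x} → x ∈ T → x ∈ V K → x ∈ TK
  onlyK x∈T x∈ with T⊆ x∈T
  ... | inj₁ x∈TK = x∈TK
  ... | inj₂ x∈TL = ⊥-elim (disjoint (x∈ , TL⊆ _ x∈TL))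
  stay : ∀ a b → (a , b) ∈ induced G T → a ∈ V K → (a , b) ∈ induced K TK × b ∈ V K
  stay a b ab a∈ with induced⁻ G T ab
  ... | arc , a∈T , b∈T with G⊆ arc
  ...   | inj₂ arcL = ⊥-elim (disjoint (a∈ , proj₁ (withinL a b arcL)))
  ...   | inj₁ arcK = induced⁺ K TK arcK (onlyK a∈T a∈) (onlyK b∈T (proj₂ (withinK a b arcK))) ,
                      proj₂ (withinK a b arcK)

acyclic-union : (H₁ H₂ : Digraph) → ArcsWithin H₁ → ArcsWithin H₂ → Disjoint (V H₁) (V H₂) →
  (T₁ T₂ : List ℕ) → (∀ x → x ∈ T₁ → x ∈ V H₁) → (∀ x → x ∈ T₂ → x ∈ V H₂) →
  Acyclic (induced H₁ T₁) → Acyclic (induced H₂ T₂) →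
  Acyclic (induced (mergeH H₁ H₂) (T₁ ++ T₂))
acyclic-union H₁ H₂ within₁ within₂ disjoint T₁ T₂ T₁⊆ T₂⊆ acyclic₁ acyclic₂ z zs u c
  with ∈-++⁻ T₁ (cycle-start (mergeH H₁ H₂) (T₁ ++ T₂) z zs c)
... | inj₁ z∈T₁ = cycle-confined (mergeH H₁ H₂) H₁ H₂ within₁ within₂ disjoint (T₁ ++ T₂) T₁ T₂
                    (∈-++⁻ (A H₁)) (∈-++⁻ T₁) T₂⊆ acyclic₁ z zs u (T₁⊆ z z∈T₁) c
... | inj₂ z∈T₂ = cycle-confined (mergeH H₁ H₂) H₂ H₁ within₂ within₁ (disjoint ∘ swap) (T₁ ++ T₂) T₂ T₁
                    (Sum.swap ∘ ∈-++⁻ (A H₁)) (Sum.swap ∘ ∈-++⁻ T₁) T₁⊆ acyclic₂ z zs u (T₂⊆ z z∈T₂) c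

restrict-colouring : {G H K : Digraph} {Y : ℕ → List ℕ} (T : List ℕ) →
  Unique T → Acyclic (induced H T) → (∀ a b → (a , b) ∈ A K → (a , b) ∈ A H) →
  (∀ u x → u ∈ V G → x ∈ Y u → x ∈ V K) → (∀ u → u ∈ V G → hits (Y u) T ≡ 1) →
  Colorable G Y K
restrict-colouring {G} {H} {K} {Y} T unique acyclic K⊆H Y⊆K one =
  filter (_∈? V K) T , filter⁺ (_∈? V K) unique ,
  (λ x x∈ → proj₂ (∈-filter⁻ (_∈? V K) {xs = T} x∈)) ,
  (λ u u∈ → trans (hits-filter (Y u) (V K) T (λ x → Y⊆K u x u∈)) (one u u∈)) ,
  acyclic-mono (induced K (filter (_∈? V K) T)) (induced H T) keep acyclic
  where
  keep : ∀ a b → (a , b) ∈ induced K (filter (_∈? V K) T) → (a , b) ∈ induced H T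
  keep a b ab with induced⁻ K (filter (_∈? V K) T) ab
  ... | arc , a∈ , b∈ = induced⁺ H T (K⊆H a b arc)
                          (proj₁ (∈-filter⁻ (_∈? V K) {xs = T} a∈)) (proj₁ (∈-filter⁻ (_∈? V K) {xs = T} b∈))

reach-map : {D G : Digraph} (f : ℕ → ℕ) → (∀ p q → (p , q) ∈ A D → (f p , f q) ∈ A G) →
  ∀ {a b} → Reach D a b → Reach G (f a) (f b)
reach-map f arcs here               = here
reach-map f arcs (fwd {u} {z} uz r) = fwd (arcs u z uz) (reach-map f arcs r)
reach-map f arcs (bwd {u} {z} zu r) = bwd (arcs z u zu) (reach-map f arcs r)

reach-trans : ∀ {G a b c} → Reach G a b → Reach G b c → Reach G a c
reach-trans here      s = s
reach-trans (fwd x r) s = fwd x (reach-trans r s)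
reach-trans (bwd x r) s = bwd x (reach-trans r s)

reach-sym : ∀ {G a b} → Reach G a b → Reach G b a
reach-sym here      = here
reach-sym (fwd x r) = reach-trans (reach-sym r) (bwd x here)
reach-sym (bwd x r) = reach-trans (reach-sym r) (fwd x here)

module Renaming (D : Digraph) (isD : IsDigraph D) (v w : ℕ) (w∉ : w ∉ V D) where

  r : ℕ → ℕ
  r = rename v w

  ren : ℕ × ℕ → ℕ × ℕ
  ren a = r (proj₁ a) , r (proj₂ a)

  r-v : r v ≡ w
  r-v = cong (λ b → if b then w else v) (dec-true (v ≟ v) refl)

  r-other : ∀ {u} → u ≢ v → r u ≡ u
  r-other {u} u≢v = cong (λ b → if b then w else u) (dec-false (u ≟ v) u≢v)

  r-w⁻¹ : ∀ {u} → u ∈ V D → r u ≡ w → u ≡ v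
  r-w⁻¹ {u} u∈ e with u ≟ v
  ... | yes u≡v = u≡v
  ... | no u≢v  = ⊥-elim (w∉ (subst (_∈ V D) (trans (sym (r-other u≢v)) e) u∈))

  r-injective : ∀ {u u'} → u ∈ V D → u' ∈ V D → r u ≡ r u' → u ≡ u'
  r-injective {u} {u'} u∈ u'∈ e with u ≟ v | u' ≟ v
  ... | yes refl | yes refl = refl
  ... | yes refl | no u'≢v  = ⊥-elim (w∉ (subst (_∈ V D) (trans (sym (r-other u'≢v)) (trans (sym e) r-v)) u'∈))
  ... | no u≢v   | yes refl = ⊥-elim (w∉ (subst (_∈ V D) (trans (sym (r-other u≢v)) (trans e r-v)) u∈))
  ... | no u≢v   | no u'≢v  = trans (sym (r-other u≢v)) (trans e (r-other u'≢v))

  ren-injective : ∀ a b → a ∈ A D → b ∈ A D → ren a ≡ ren b → a ≡ b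
  ren-injective (p , q) (p' , q') pq p'q' e with IsDigraph.A-ends isD p q pq | IsDigraph.A-ends isD p' q' p'q'
  ... | p∈ , q∈ | p'∈ , q'∈ = cong₂ _,_ (r-injective p∈ p'∈ (cong proj₁ e)) (r-injective q∈ q'∈ (cong proj₂ e))

  ren-loopless : ∀ p q → (p , q) ∈ A D → r p ≢ r q
  ren-loopless p q pq e with IsDigraph.A-ends isD p q pq
  ... | p∈ , q∈ = IsDigraph.no-loops isD p q pq (r-injective p∈ q∈ e)

  r-range : ∀ {u t} → u ∈ V D → r u ≡ t → t ≢ w → t ∈ V D
  r-range {u} u∈ e t≢w with u ≟ v
  ... | yes refl = ⊥-elim (t≢w (trans (sym e) r-v))
  ... | no u≢v   = subst (_∈ V D) (trans (sym (r-other u≢v)) e) u∈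

  near-ren : ∀ d a → near d (ren a) ≡ r (near d a)
  near-ren In  a = refl
  near-ren Out a = refl

  degree-ren : ∀ d {u t} → u ∈ V D → r u ≡ t → count (λ a → near d (ren a) ≟ t) (A D) ≡ degree d D u
  degree-ren d {u} {t} u∈ e = count-cong (λ a → near d (ren a) ≟ t) (λ a → near d a ≟ u) (A D)
    (λ a a∈ e' → r-injective (near-∈ isD d a∈) u∈ (trans (sym (near-ren d a)) (trans e' (sym e))))
    (λ a a∈ e' → trans (near-ren d a) (trans (cong r e') e))

  degree-ren-outside : ∀ d {t} → t ∉ V D → t ≢ w → count (λ a → near d (ren a) ≟ t) (A D) ≡ 0
  degree-ren-outside d t∉ t≢w = count-zero (λ a → near d (ren a) ≟ _) (A D)
    (λ a a∈ e → t∉ (r-range (near-∈ isD d a∈) (trans (sym (near-ren d a)) e) t≢w))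

module Merge (D1 H1 D2 H2 : Digraph) (X1 X2 : ℕ → List ℕ) (v1 v2 w : ℕ)
  (F1 : Feasible D1 X1 H1) (F2 : Feasible D2 X2 H2)
  (disjointD : Disjoint (V D1) (V D2)) (disjointH : Disjoint (V H1) (V H2))
  (v1∈ : v1 ∈ V D1) (v2∈ : v2 ∈ V D2) (w∉1 : w ∉ V D1) (w∉2 : w ∉ V D2) where

  open ≡-Reasoning

  M : Digraph
  M = mergeD D1 D2 v1 v2 w

  XM : ℕ → List ℕ
  XM = mergeX D1 X1 X2 v1 v2 w

  HM : Digraph
  HM = mergeH H1 H2

  module C1 = IsCover (Feasible.cover F1)
  module C2 = IsCover (Feasible.cover F2)
  module R1 = Renaming D1 (Feasible.D-digraph F1) v1 w w∉1
  module R2 = Renaming D2 (Feasible.D-digraph F2) v2 w w∉2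

  old₁ : ∀ {u} → u ∈ V D1 → u ≢ v1 → u ∈ V M
  old₁ u∈ u≢v1 = there (∈-++⁺ˡ (∈-without⁺ v1 (V D1) u∈ u≢v1))

  old₂ : ∀ {u} → u ∈ V D2 → u ≢ v2 → u ∈ V M
  old₂ u∈ u≢v2 = there (∈-++⁺ʳ (without v1 (V D1)) (∈-without⁺ v2 (V D2) u∈ u≢v2))

  vertex-cases : ∀ {v} → v ∈ V M → v ≡ w ⊎ (v ∈ V D1 × v ≢ v1) ⊎ (v ∈ V D2 × v ≢ v2)
  vertex-cases (here refl) = inj₁ refl
  vertex-cases (there v∈) with ∈-++⁻ (without v1 (V D1)) v∈
  ... | inj₁ v∈₁ = inj₂ (inj₁ (∈-without⁻ v1 (V D1) v∈₁))
  ... | inj₂ v∈₂ = inj₂ (inj₂ (∈-without⁻ v2 (V D2) v∈₂))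

  renamed₁ : ∀ {p} → p ∈ V D1 → R1.r p ∈ V M
  renamed₁ {p} p∈ with p ≟ v1
  ... | yes refl = subst (_∈ V M) (sym R1.r-v) (here refl)
  ... | no p≢v1  = subst (_∈ V M) (sym (R1.r-other p≢v1)) (old₁ p∈ p≢v1)

  renamed₂ : ∀ {p} → p ∈ V D2 → R2.r p ∈ V M
  renamed₂ {p} p∈ with p ≟ v2
  ... | yes refl = subst (_∈ V M) (sym R2.r-v) (here refl)
  ... | no p≢v2  = subst (_∈ V M) (sym (R2.r-other p≢v2)) (old₂ p∈ p≢v2)

  meet-at-w : ∀ {p q} → p ∈ V D1 → q ∈ V D2 → R1.r p ≡ R2.r q → p ≡ v1 × q ≡ v2
  meet-at-w {p} {q} p∈ q∈ e with R1.r p ≟ w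
  ... | yes e' = R1.r-w⁻¹ p∈ e' , R2.r-w⁻¹ q∈ (trans (sym e) e')
  ... | no ne  = ⊥-elim (disjointD (R1.r-range p∈ refl ne , R2.r-range q∈ (sym e) ne))

  XM-w : XM w ≡ X1 v1 ++ X2 v2
  XM-w = cong (λ b → if b then X1 v1 ++ X2 v2 else (if does (w ∈? V D1) then X1 w else X2 w))
              (dec-true (w ≟ w) refl)

  XM₁ : ∀ {u} → u ∈ V D1 → XM u ≡ X1 u
  XM₁ {u} u∈ =
    trans (cong (λ b → if b then X1 v1 ++ X2 v2 else (if does (u ∈? V D1) then X1 u else X2 u))
                (dec-false (u ≟ w) λ { refl → w∉1 u∈ }))
          (cong (λ b → if b then X1 u else X2 u) (dec-true (u ∈? V D1) u∈))

  XM₂ : ∀ {u} → u ∈ V D2 → XM u ≡ X2 u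
  XM₂ {u} u∈ =
    trans (cong (λ b → if b then X1 v1 ++ X2 v2 else (if does (u ∈? V D1) then X1 u else X2 u))
                (dec-false (u ≟ w) λ { refl → w∉2 u∈ }))
          (cong (λ b → if b then X1 u else X2 u) (dec-false (u ∈? V D1) λ u∈₁ → disjointD (u∈₁ , u∈)))

  colours₁ : ∀ {p x} → p ∈ V D1 → x ∈ X1 p → x ∈ XM (R1.r p)
  colours₁ {p} {x} p∈ x∈ with p ≟ v1
  ... | yes refl = subst (λ t → x ∈ XM t) (sym R1.r-v) (subst (x ∈_) (sym XM-w) (∈-++⁺ˡ x∈))
  ... | no p≢v1  = subst (λ t → x ∈ XM t) (sym (R1.r-other p≢v1)) (subst (x ∈_) (sym (XM₁ p∈)) x∈)

  colours₂ : ∀ {p x} → p ∈ V D2 → x ∈ X2 p → x ∈ XM (R2.r p)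
  colours₂ {p} {x} p∈ x∈ with p ≟ v2
  ... | yes refl = subst (λ t → x ∈ XM t) (sym R2.r-v) (subst (x ∈_) (sym XM-w) (∈-++⁺ʳ (X1 v1) x∈))
  ... | no p≢v2  = subst (λ t → x ∈ XM t) (sym (R2.r-other p≢v2)) (subst (x ∈_) (sym (XM₂ p∈)) x∈)

  disjoint-at-w : Disjoint (X1 v1) (X2 v2)
  disjoint-at-w (x∈₁ , x∈₂) = disjointH (C1.VH-sup v1 _ v1∈ x∈₁ , C2.VH-sup v2 _ v2∈ x∈₂)

  arcs-apart : ∀ {a} → a ∈ A H1 → a ∉ A H2
  arcs-apart {x , y} a∈₁ a∈₂ = disjointH (proj₁ (IsDigraph.A-ends (Feasible.H-digraph F1) x y a∈₁) ,
                                          proj₁ (IsDigraph.A-ends (Feasible.H-digraph F2) x y a∈₂))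

  Owner₁ Owner₂ : ℕ → ℕ → Set
  Owner₁ v x = Σ ℕ λ p → p ∈ V D1 × R1.r p ≡ v × x ∈ X1 p
  Owner₂ v x = Σ ℕ λ p → p ∈ V D2 × R2.r p ≡ v × x ∈ X2 p

  owner : ∀ {v x} → v ∈ V M → x ∈ XM v → Owner₁ v x ⊎ Owner₂ v x
  owner {v} {x} v∈ x∈ with vertex-cases v∈
  ... | inj₁ refl with ∈-++⁻ (X1 v1) (subst (x ∈_) XM-w x∈)
  ...   | inj₁ x∈₁ = inj₁ (v1 , v1∈ , R1.r-v , x∈₁)
  ...   | inj₂ x∈₂ = inj₂ (v2 , v2∈ , R2.r-v , x∈₂)
  owner {v} {x} v∈ x∈ | inj₂ (inj₁ (v∈₁ , v≢v1)) = inj₁ (v , v∈₁ , R1.r-other v≢v1 , subst (x ∈_) (XM₁ v∈₁) x∈)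
  owner {v} {x} v∈ x∈ | inj₂ (inj₂ (v∈₂ , v≢v2)) = inj₂ (v , v∈₂ , R2.r-other v≢v2 , subst (x ∈_) (XM₂ v∈₂) x∈)

  owner₁ : ∀ {v x} → v ∈ V M → x ∈ XM v → x ∈ V H1 → Owner₁ v x
  owner₁ v∈ x∈ x∈H with owner v∈ x∈
  ... | inj₁ o                = o
  ... | inj₂ (p , p∈ , _ , x∈p) = ⊥-elim (disjointH (x∈H , C2.VH-sup p _ p∈ x∈p))

  owner₂ : ∀ {v x} → v ∈ V M → x ∈ XM v → x ∈ V H2 → Owner₂ v x
  owner₂ v∈ x∈ x∈H with owner v∈ x∈
  ... | inj₂ o                = o
  ... | inj₁ (p , p∈ , _ , x∈p) = ⊥-elim (disjointH (C1.VH-sup p _ p∈ x∈p , x∈H))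

  arc₁ : ∀ p q → (p , q) ∈ A D1 → (R1.r p , R1.r q) ∈ A M
  arc₁ p q pq = ∈-++⁺ˡ (∈-map⁺ R1.ren pq)

  arc₂ : ∀ p q → (p , q) ∈ A D2 → (R2.r p , R2.r q) ∈ A M
  arc₂ p q pq = ∈-++⁺ʳ (map R1.ren (A D1)) (∈-map⁺ R2.ren pq)

  arc-cases : ∀ {a b} → (a , b) ∈ A M →
    (Σ ℕ λ p → Σ ℕ λ q → (p , q) ∈ A D1 × R1.r p ≡ a × R1.r q ≡ b) ⊎
    (Σ ℕ λ p → Σ ℕ λ q → (p , q) ∈ A D2 × R2.r p ≡ a × R2.r q ≡ b)
  arc-cases ab with ∈-++⁻ (map R1.ren (A D1)) ab
  ... | inj₁ ab₁ with ∈-map⁻ R1.ren ab₁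
  ...   | (p , q) , pq , refl = inj₁ (p , q , pq , refl , refl)
  arc-cases ab | inj₂ ab₂ with ∈-map⁻ R2.ren ab₂
  ...   | (p , q) , pq , refl = inj₂ (p , q , pq , refl , refl)

  -- M is a digraph: renaming is injective on each side, and an arc of D1 and
  -- an arc of D2 could only get the same name if both were loops at w.
  M-digraph : IsDigraph M
  M-digraph = record
    { V-unique = tabulate (λ w∈ → λ { refl → w-fresh w∈ })
                 ∷ ++⁺ (filter⁺ _ (IsDigraph.V-unique isD1)) (filter⁺ _ (IsDigraph.V-unique isD2))
                       (λ (u∈₁ , u∈₂) → disjointD (∈-without⁻ₗ u∈₁ , ∈-without⁻ₗ u∈₂))
    ; A-unique = ++⁺ (unique-map R1.ren (A D1) R1.ren-injective (IsDigraph.A-unique isD1))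
                     (unique-map R2.ren (A D2) R2.ren-injective (IsDigraph.A-unique isD2)) apart
    ; A-ends   = ends
    ; no-loops = no-loops }
    where
    isD1 = Feasible.D-digraph F1
    isD2 = Feasible.D-digraph F2
    w-fresh : w ∉ without v1 (V D1) ++ without v2 (V D2)
    w-fresh w∈ with ∈-++⁻ (without v1 (V D1)) w∈
    ... | inj₁ w∈₁ = w∉1 (∈-without⁻ₗ w∈₁)
    ... | inj₂ w∈₂ = w∉2 (∈-without⁻ₗ w∈₂)
    apart : Disjoint (map R1.ren (A D1)) (map R2.ren (A D2))
    apart (a∈₁ , a∈₂) with ∈-map⁻ R1.ren a∈₁ | ∈-map⁻ R2.ren a∈₂
    ... | (p , q) , pq , refl | (p' , q') , p'q' , e
      with IsDigraph.A-ends isD1 p q pq | IsDigraph.A-ends isD2 p' q' p'q'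
    ... | p∈ , q∈ | p'∈ , q'∈ =
      IsDigraph.no-loops isD1 p q pq (trans (proj₁ (meet-at-w p∈ p'∈ (cong proj₁ e)))
                                            (sym (proj₁ (meet-at-w q∈ q'∈ (cong proj₂ e)))))
    ends : ∀ a b → (a , b) ∈ A M → a ∈ V M × b ∈ V M
    ends a b ab with arc-cases ab
    ... | inj₁ (p , q , pq , refl , refl) = Product.map renamed₁ renamed₁ (IsDigraph.A-ends isD1 p q pq)
    ... | inj₂ (p , q , pq , refl , refl) = Product.map renamed₂ renamed₂ (IsDigraph.A-ends isD2 p q pq)
    no-loops : ∀ a b → (a , b) ∈ A M → a ≢ b
    no-loops a b ab e with arc-cases ab
    ... | inj₁ (p , q , pq , refl , refl) = R1.ren-loopless p q pq e
    ... | inj₂ (p , q , pq , refl , refl) = R2.ren-loopless p q pq e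

  HM-digraph : IsDigraph HM
  HM-digraph = record
    { V-unique = ++⁺ (IsDigraph.V-unique isH1) (IsDigraph.V-unique isH2) disjointH
    ; A-unique = ++⁺ (IsDigraph.A-unique isH1) (IsDigraph.A-unique isH2) (λ (a∈₁ , a∈₂) → arcs-apart a∈₁ a∈₂)
    ; A-ends   = ends
    ; no-loops = no-loops }
    where
    isH1 = Feasible.H-digraph F1
    isH2 = Feasible.H-digraph F2
    ends : ∀ a b → (a , b) ∈ A HM → a ∈ V HM × b ∈ V HM
    ends a b ab with ∈-++⁻ (A H1) ab
    ... | inj₁ ab₁ = Product.map ∈-++⁺ˡ ∈-++⁺ˡ (IsDigraph.A-ends isH1 a b ab₁)
    ... | inj₂ ab₂ = Product.map (∈-++⁺ʳ (V H1)) (∈-++⁺ʳ (V H1)) (IsDigraph.A-ends isH2 a b ab₂)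
    no-loops : ∀ a b → (a , b) ∈ A HM → a ≢ b
    no-loops a b ab with ∈-++⁻ (A H1) ab
    ... | inj₁ ab₁ = IsDigraph.no-loops isH1 a b ab₁
    ... | inj₂ ab₂ = IsDigraph.no-loops isH2 a b ab₂

  -- M is connected: every vertex reaches w, through the image of D1 or D2.
  M-connected : Connected M
  M-connected u v u∈ v∈ = reach-trans (to-w u∈) (reach-sym (to-w v∈))
    where
    relabel : ∀ {a a' b b'} → a ≡ a' → b ≡ b' → Reach M a b → Reach M a' b'
    relabel refl refl walk = walk
    to-w : ∀ {v} → v ∈ V M → Reach M v w
    to-w v∈ with vertex-cases v∈
    ... | inj₁ refl = here
    ... | inj₂ (inj₁ (v∈₁ , v≢v1)) =
      relabel (R1.r-other v≢v1) R1.r-v (reach-map R1.r arc₁ (Feasible.connected F1 _ v1 v∈₁ v1∈))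
    ... | inj₂ (inj₂ (v∈₂ , v≢v2)) =
      relabel (R2.r-other v≢v2) R2.r-v (reach-map R2.r arc₂ (Feasible.connected F2 _ v2 v∈₂ v2∈))

  -- Over an arc of D1, an arc of HM between the corresponding colour lists is an
  -- arc of H1: an arc of H2 there would force both ends of the D1-arc to be v1.
  lift₁ : ∀ {p q x y} → (p , q) ∈ A D1 → (x , y) ∈ A HM → x ∈ XM (R1.r p) → y ∈ XM (R1.r q) →
    (x , y) ∈ A H1 × x ∈ X1 p × y ∈ X1 q
  lift₁ {p} {q} {x} {y} pq xy x∈ y∈ with IsDigraph.A-ends (Feasible.D-digraph F1) p q pq | ∈-++⁻ (A H1) xy
  ... | p∈ , q∈ | inj₁ xy₁ with IsDigraph.A-ends (Feasible.H-digraph F1) x y xy₁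
  ...   | x∈H , y∈H with owner₁ (renamed₁ p∈) x∈ x∈H | owner₁ (renamed₁ q∈) y∈ y∈H
  ...     | p' , p'∈ , e , x∈p' | q' , q'∈ , e' , y∈q'
            with R1.r-injective p'∈ p∈ e | R1.r-injective q'∈ q∈ e'
  ...       | refl | refl = xy₁ , x∈p' , y∈q'
  lift₁ {p} {q} {x} {y} pq xy x∈ y∈ | p∈ , q∈ | inj₂ xy₂ with IsDigraph.A-ends (Feasible.H-digraph F2) x y xy₂
  ...   | x∈H , y∈H with owner₂ (renamed₁ p∈) x∈ x∈H | owner₂ (renamed₁ q∈) y∈ y∈H
  ...     | p' , p'∈ , e , _ | q' , q'∈ , e' , _ = ⊥-elim (IsDigraph.no-loops (Feasible.D-digraph F1) p q pq
            (trans (proj₁ (meet-at-w p∈ p'∈ (sym e))) (sym (proj₁ (meet-at-w q∈ q'∈ (sym e'))))))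

  lift₂ : ∀ {p q x y} → (p , q) ∈ A D2 → (x , y) ∈ A HM → x ∈ XM (R2.r p) → y ∈ XM (R2.r q) →
    (x , y) ∈ A H2 × x ∈ X2 p × y ∈ X2 q
  lift₂ {p} {q} {x} {y} pq xy x∈ y∈ with IsDigraph.A-ends (Feasible.D-digraph F2) p q pq | ∈-++⁻ (A H1) xy
  ... | p∈ , q∈ | inj₂ xy₂ with IsDigraph.A-ends (Feasible.H-digraph F2) x y xy₂
  ...   | x∈H , y∈H with owner₂ (renamed₂ p∈) x∈ x∈H | owner₂ (renamed₂ q∈) y∈ y∈H
  ...     | p' , p'∈ , e , x∈p' | q' , q'∈ , e' , y∈q'
            with R2.r-injective p'∈ p∈ e | R2.r-injective q'∈ q∈ e'
  ...       | refl | refl = xy₂ , x∈p' , y∈q'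
  lift₂ {p} {q} {x} {y} pq xy x∈ y∈ | p∈ , q∈ | inj₁ xy₁ with IsDigraph.A-ends (Feasible.H-digraph F1) x y xy₁
  ...   | x∈H , y∈H with owner₁ (renamed₂ p∈) x∈ x∈H | owner₁ (renamed₂ q∈) y∈ y∈H
  ...     | p' , p'∈ , e , _ | q' , q'∈ , e' , _ = ⊥-elim (IsDigraph.no-loops (Feasible.D-digraph F2) p q pq
            (trans (proj₂ (meet-at-w p'∈ p∈ e)) (sym (proj₂ (meet-at-w q'∈ q∈ e')))))

  XM-unique : ∀ v → v ∈ V M → Unique (XM v)
  XM-unique v v∈ with vertex-cases v∈
  ... | inj₁ refl = subst Unique (sym XM-w) (++⁺ (C1.X-unique v1 v1∈) (C2.X-unique v2 v2∈) disjoint-at-w)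
  ... | inj₂ (inj₁ (v∈₁ , _)) = subst Unique (sym (XM₁ v∈₁)) (C1.X-unique v v∈₁)
  ... | inj₂ (inj₂ (v∈₂ , _)) = subst Unique (sym (XM₂ v∈₂)) (C2.X-unique v v∈₂)

  -- Distinct vertices of M have distinct owners on one side, or owners on
  -- different sides whose colours lie in the disjoint digraphs H1 and H2.
  XM-disjoint : ∀ u v → u ∈ V M → v ∈ V M → u ≢ v → Disjoint (XM u) (XM v)
  XM-disjoint u v u∈ v∈ u≢v (x∈u , x∈v) with owner u∈ x∈u | owner v∈ x∈v
  ... | inj₁ (p , p∈ , refl , x∈p) | inj₁ (p' , p'∈ , refl , x∈p') =
    u≢v (cong R1.r (Greedy.owner-unique F1 p∈ p'∈ x∈p x∈p'))
  ... | inj₁ (p , p∈ , _ , x∈p) | inj₂ (p' , p'∈ , _ , x∈p') = disjointH (C1.VH-sup p _ p∈ x∈p , C2.VH-sup p' _ p'∈ x∈p')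
  ... | inj₂ (p , p∈ , _ , x∈p) | inj₁ (p' , p'∈ , _ , x∈p') = disjointH (C1.VH-sup p' _ p'∈ x∈p' , C2.VH-sup p _ p∈ x∈p)
  ... | inj₂ (p , p∈ , refl , x∈p) | inj₂ (p' , p'∈ , refl , x∈p') =
    u≢v (cong R2.r (Greedy.owner-unique F2 p∈ p'∈ x∈p x∈p'))

  HM-covered : ∀ x → x ∈ V HM → Σ ℕ λ v → v ∈ V M × x ∈ XM v
  HM-covered x x∈ with ∈-++⁻ (V H1) x∈
  ... | inj₁ x∈₁ with C1.VH-sub x x∈₁
  ...   | p , p∈ , x∈p = R1.r p , renamed₁ p∈ , colours₁ p∈ x∈p
  HM-covered x x∈ | inj₂ x∈₂ with C2.VH-sub x x∈₂
  ...   | p , p∈ , x∈p = R2.r p , renamed₂ p∈ , colours₂ p∈ x∈p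

  HM-owned : ∀ v x → v ∈ V M → x ∈ XM v → x ∈ V HM
  HM-owned v x v∈ x∈ with owner v∈ x∈
  ... | inj₁ (p , p∈ , _ , x∈p) = ∈-++⁺ˡ (C1.VH-sup p x p∈ x∈p)
  ... | inj₂ (p , p∈ , _ , x∈p) = ∈-++⁺ʳ (V H1) (C2.VH-sup p x p∈ x∈p)

  -- Both ends of an arc inside one colour list would have the same owner.
  XM-independent : ∀ v x y → v ∈ V M → (x , y) ∈ A HM → ¬ (x ∈ XM v × y ∈ XM v)
  XM-independent v x y v∈ xy (x∈ , y∈) with ∈-++⁻ (A H1) xy
  ... | inj₁ xy₁ with IsDigraph.A-ends (Feasible.H-digraph F1) x y xy₁
  ...   | x∈H , y∈H with owner₁ v∈ x∈ x∈H | owner₁ v∈ y∈ y∈H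
  ...     | p , p∈ , e , x∈p | q , q∈ , e' , y∈q with R1.r-injective p∈ q∈ (trans e (sym e'))
  ...       | refl = C1.X-indep p x y p∈ xy₁ (x∈p , y∈q)
  XM-independent v x y v∈ xy (x∈ , y∈) | inj₂ xy₂ with IsDigraph.A-ends (Feasible.H-digraph F2) x y xy₂
  ...   | x∈H , y∈H with owner₂ v∈ x∈ x∈H | owner₂ v∈ y∈ y∈H
  ...     | p , p∈ , e , x∈p | q , q∈ , e' , y∈q with R2.r-injective p∈ q∈ (trans e (sym e'))
  ...       | refl = C2.X-indep p x y p∈ xy₂ (x∈p , y∈q)

  HM-arises : ∀ x y → (x , y) ∈ A HM → Σ ℕ λ u → Σ ℕ λ v → (u , v) ∈ A M × x ∈ XM u × y ∈ XM v
  HM-arises x y xy with ∈-++⁻ (A H1) xy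
  ... | inj₁ xy₁ with C1.arises x y xy₁
  ...   | p , q , pq , x∈ , y∈ = R1.r p , R1.r q , arc₁ p q pq , colours₁ (proj₁ ends) x∈ , colours₁ (proj₂ ends) y∈
    where ends = IsDigraph.A-ends (Feasible.D-digraph F1) p q pq
  HM-arises x y xy | inj₂ xy₂ with C2.arises x y xy₂
  ...   | p , q , pq , x∈ , y∈ = R2.r p , R2.r q , arc₂ p q pq , colours₂ (proj₁ ends) x∈ , colours₂ (proj₂ ends) y∈
    where ends = IsDigraph.A-ends (Feasible.D-digraph F2) p q pq

  -- By lift₁ and lift₂, the arcs of HM over an arc of M are those over the
  -- corresponding arc of one side.
  HM-matching : ∀ u v → (u , v) ∈ A M → ∀ x y x' y' → (x , y) ∈ A HM → (x' , y') ∈ A HM →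
    x ∈ XM u → y ∈ XM v → x' ∈ XM u → y' ∈ XM v → (x ≡ x' → y ≡ y') × (y ≡ y' → x ≡ x')
  HM-matching u v uv x y x' y' xy x'y' x∈ y∈ x'∈ y'∈ with arc-cases uv
  ... | inj₁ (p , q , pq , refl , refl) with lift₁ pq xy x∈ y∈ | lift₁ pq x'y' x'∈ y'∈
  ...   | xy₁ , x∈p , y∈q | x'y'₁ , x'∈p , y'∈q = C1.matching p q pq x y x' y' xy₁ x'y'₁ x∈p y∈q x'∈p y'∈q
  HM-matching u v uv x y x' y' xy x'y' x∈ y∈ x'∈ y'∈ | inj₂ (p , q , pq , refl , refl)
    with lift₂ pq xy x∈ y∈ | lift₂ pq x'y' x'∈ y'∈
  ...   | xy₂ , x∈p , y∈q | x'y'₂ , x'∈p , y'∈q = C2.matching p q pq x y x' y' xy₂ x'y'₂ x∈p y∈q x'∈p y'∈q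

  M-cover : IsCover M XM HM
  M-cover = record
    { X-unique   = XM-unique
    ; X-disjoint = XM-disjoint
    ; VH-sub     = HM-covered
    ; VH-sup     = HM-owned
    ; X-indep    = XM-independent
    ; arises     = HM-arises
    ; matching   = HM-matching }

  M-feasible : Feasible M XM HM
  M-feasible = record { D-digraph = M-digraph ; H-digraph = HM-digraph ; connected = M-connected ; cover = M-cover }

  degree-split : ∀ d t → degree d M t ≡
    count (λ a → near d (R1.ren a) ≟ t) (A D1) + count (λ a → near d (R2.ren a) ≟ t) (A D2)
  degree-split d t = trans (count-++ (λ a → near d a ≟ t) (map R1.ren (A D1)) (map R2.ren (A D2)))
    (cong₂ _+_ (count-map (λ a → near d a ≟ t) R1.ren (A D1)) (count-map (λ a → near d a ≟ t) R2.ren (A D2)))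

  degree-w : ∀ d → degree d M w ≡ degree d D1 v1 + degree d D2 v2
  degree-w d = trans (degree-split d w) (cong₂ _+_ (R1.degree-ren d v1∈ R1.r-v) (R2.degree-ren d v2∈ R2.r-v))

  degree-old₁ : ∀ d {u} → u ∈ V D1 → u ≢ v1 → degree d M u ≡ degree d D1 u
  degree-old₁ d u∈ u≢v1 = trans (degree-split d _) (trans
    (cong₂ _+_ (R1.degree-ren d u∈ (R1.r-other u≢v1))
               (R2.degree-ren-outside d (λ u∈₂ → disjointD (u∈ , u∈₂)) λ { refl → w∉1 u∈ }))
    (+-identityʳ _))

  degree-old₂ : ∀ d {u} → u ∈ V D2 → u ≢ v2 → degree d M u ≡ degree d D2 u
  degree-old₂ d u∈ u≢v2 = trans (degree-split d _)
    (cong₂ _+_ (R1.degree-ren-outside d (λ u∈₁ → disjointD (u∈₁ , u∈)) λ { refl → w∉2 u∈ })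
               (R2.degree-ren d u∈ (R2.r-other u≢v2)))

  length-XM-w : length (XM w) ≡ length (X1 v1) + length (X2 v2)
  length-XM-w = trans (cong length XM-w) (length-++ (X1 v1))

  glue : (As₁ As₂ : List (ℕ × ℕ)) →
    (∀ a b → (a , b) ∈ As₁ → (a , b) ∈ A H1) → (∀ a b → (a , b) ∈ As₂ → (a , b) ∈ A H2) →
    ∀ {k₁ k₂ T₁ T₂} → Transversal D1 X1 (withArcs H1 As₁) v1 k₁ T₁ → Transversal D2 X2 (withArcs H2 As₂) v2 k₂ T₂ →
    k₁ + k₂ ≡ 1 → Colorable M XM (mergeH (withArcs H1 As₁) (withArcs H2 As₂))
  glue As₁ As₂ sub₁ sub₂ {k₁} {k₂} {T₁} {T₂} t₁ t₂ k₁+k₂≡1 =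
    T₁ ++ T₂ ,
    ++⁺ t₁.unique t₂.unique (λ (x∈₁ , x∈₂) → disjointH (t₁.inside _ x∈₁ , t₂.inside _ x∈₂)) ,
    inside , hits-one ,
    acyclic-union (withArcs H1 As₁) (withArcs H2 As₂) within₁ within₂ disjointH T₁ T₂
                  t₁.inside t₂.inside t₁.acyclic t₂.acyclic
    where
    module t₁ = Transversal t₁
    module t₂ = Transversal t₂
    within₁ : ArcsWithin (withArcs H1 As₁)
    within₁ a b ab = IsDigraph.A-ends (Feasible.H-digraph F1) a b (sub₁ a b ab)
    within₂ : ArcsWithin (withArcs H2 As₂)
    within₂ a b ab = IsDigraph.A-ends (Feasible.H-digraph F2) a b (sub₂ a b ab)
    inside : ∀ x → x ∈ T₁ ++ T₂ → x ∈ V H1 ++ V H2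
    inside x x∈ with ∈-++⁻ T₁ x∈
    ... | inj₁ x∈₁ = ∈-++⁺ˡ (t₁.inside x x∈₁)
    ... | inj₂ x∈₂ = ∈-++⁺ʳ (V H1) (t₂.inside x x∈₂)
    miss₁ : ∀ {p} → p ∈ V D1 → hits (X1 p) T₂ ≡ 0
    miss₁ p∈ = count-zero (_∈? X1 _) T₂ (λ x x∈ x∈p → disjointH (C1.VH-sup _ x p∈ x∈p , t₂.inside x x∈))
    miss₂ : ∀ {p} → p ∈ V D2 → hits (X2 p) T₁ ≡ 0
    miss₂ p∈ = count-zero (_∈? X2 _) T₁ (λ x x∈ x∈p → disjointH (t₁.inside x x∈ , C2.VH-sup _ x p∈ x∈p))
    hits-one : ∀ v → v ∈ V M → hits (XM v) (T₁ ++ T₂) ≡ 1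
    hits-one v v∈ with vertex-cases v∈
    ... | inj₁ refl = begin
      hits (XM w) (T₁ ++ T₂)
        ≡⟨ cong (λ S → hits S (T₁ ++ T₂)) XM-w ⟩
      hits (X1 v1 ++ X2 v2) (T₁ ++ T₂)
        ≡⟨ hits-disjoint-++ (X1 v1) (X2 v2) (T₁ ++ T₂) disjoint-at-w ⟩
      hits (X1 v1) (T₁ ++ T₂) + hits (X2 v2) (T₁ ++ T₂)
        ≡⟨ cong₂ _+_ (count-++ _ T₁ T₂) (count-++ _ T₁ T₂) ⟩
      (hits (X1 v1) T₁ + hits (X1 v1) T₂) + (hits (X2 v2) T₁ + hits (X2 v2) T₂)
        ≡⟨ cong₂ _+_ (cong₂ _+_ t₁.hits-at (miss₁ v1∈)) (cong₂ _+_ (miss₂ v2∈) t₂.hits-at) ⟩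
      (k₁ + 0) + k₂
        ≡⟨ cong (_+ k₂) (+-identityʳ k₁) ⟩
      k₁ + k₂
        ≡⟨ k₁+k₂≡1 ⟩
      1 ∎
    ... | inj₂ (inj₁ (v∈₁ , v≢v1)) = begin
      hits (XM v) (T₁ ++ T₂)            ≡⟨ cong (λ S → hits S (T₁ ++ T₂)) (XM₁ v∈₁) ⟩
      hits (X1 v) (T₁ ++ T₂)            ≡⟨ count-++ _ T₁ T₂ ⟩
      hits (X1 v) T₁ + hits (X1 v) T₂   ≡⟨ cong₂ _+_ (t₁.hits-off v v∈₁ v≢v1) (miss₁ v∈₁) ⟩
      1                                 ∎
    ... | inj₂ (inj₂ (v∈₂ , v≢v2)) = begin
      hits (XM v) (T₁ ++ T₂)            ≡⟨ cong (λ S → hits S (T₁ ++ T₂)) (XM₂ v∈₂) ⟩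
      hits (X2 v) (T₁ ++ T₂)            ≡⟨ count-++ _ T₁ T₂ ⟩
      hits (X2 v) T₁ + hits (X2 v) T₂   ≡⟨ cong₂ _+_ (miss₂ v∈₂) (t₂.hits-off v v∈₂ v≢v2) ⟩
      1                                 ∎

  shared-at-w : ∀ T → hits (XM w) T ≡ 1 → hits (X1 v1) T + hits (X2 v2) T ≡ 1
  shared-at-w T one = trans (sym (hits-disjoint-++ (X1 v1) (X2 v2) T disjoint-at-w))
                            (trans (cong (λ S → hits S T) (sym XM-w)) one)

  -- Conversely, a colouring of M colours w from exactly one side, and then
  -- restricts to a colouring of that side.
  split : (As₁ As₂ : List (ℕ × ℕ)) →
    Colorable M XM (mergeH (withArcs H1 As₁) (withArcs H2 As₂)) →
    Colorable D1 X1 (withArcs H1 As₁) ⊎ Colorable D2 X2 (withArcs H2 As₂)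
  split As₁ As₂ (T , unique , inside , hits-one , acyclic)
    with one-of (hits (X1 v1) T) (hits (X2 v2) T) (shared-at-w T (hits-one w (here refl)))
  ... | inj₁ at-v1 = inj₁ (restrict-colouring {G = D1} {H = mergeH (withArcs H1 As₁) (withArcs H2 As₂)} {K = withArcs H1 As₁}
                            T unique acyclic (λ a b → ∈-++⁺ˡ) C1.VH-sup one₁)
    where
    one₁ : ∀ u → u ∈ V D1 → hits (X1 u) T ≡ 1
    one₁ u u∈ with u ≟ v1
    ... | yes refl = at-v1
    ... | no u≢v1  = trans (cong (λ S → hits S T) (sym (XM₁ u∈))) (hits-one u (old₁ u∈ u≢v1))
  ... | inj₂ at-v2 = inj₂ (restrict-colouring {G = D2} {H = mergeH (withArcs H1 As₁) (withArcs H2 As₂)} {K = withArcs H2 As₂}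
                            T unique acyclic (λ a b → ∈-++⁺ʳ As₁) C2.VH-sup one₂)
    where
    one₂ : ∀ u → u ∈ V D2 → hits (X2 u) T ≡ 1
    one₂ u u∈ with u ≟ v2
    ... | yes refl = at-v2
    ... | no u≢v2  = trans (cong (λ S → hits S T) (sym (XM₂ u∈))) (hits-one u (old₂ u∈ u≢v2))

  room₁ : DegreeFeasible M XM → ∀ u → u ∈ V D1 → u ≢ v1 → ∀ d → degree d D1 u ≤ length (X1 u)
  room₁ feasible u u∈ u≢v1 d =
    subst₂ _≤_ (degree-old₁ d u∈ u≢v1) (cong length (XM₁ u∈)) (degree-bound M XM feasible (old₁ u∈ u≢v1) d)

  room₂ : DegreeFeasible M XM → ∀ u → u ∈ V D2 → u ≢ v2 → ∀ d → degree d D2 u ≤ length (X2 u)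
  room₂ feasible u u∈ u≢v2 d =
    subst₂ _≤_ (degree-old₂ d u∈ u≢v2) (cong length (XM₂ u∈)) (degree-bound M XM feasible (old₂ u∈ u≢v2) d)

  room-w : DegreeFeasible M XM → ∀ d → degree d D1 v1 + degree d D2 v2 ≤ length (X1 v1) + length (X2 v2)
  room-w feasible d = subst₂ _≤_ (degree-w d) length-XM-w (degree-bound M XM feasible (here refl) d)

  merge-degree-feasible : DegreeFeasible D1 X1 → DegreeFeasible D2 X2 → DegreeFeasible M XM
  merge-degree-feasible feasible₁ feasible₂ = degree-feasible M XM bound
    where
    bound : ∀ v → v ∈ V M → ∀ d → degree d M v ≤ length (XM v)
    bound v v∈ d with vertex-cases v∈
    ... | inj₁ refl = subst₂ _≤_ (sym (degree-w d)) (sym length-XM-w)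
                        (+-mono-≤ (degree-bound D1 X1 feasible₁ v1∈ d) (degree-bound D2 X2 feasible₂ v2∈ d))
    ... | inj₂ (inj₁ (v∈₁ , v≢v1)) = subst₂ _≤_ (sym (degree-old₁ d v∈₁ v≢v1)) (cong length (sym (XM₁ v∈₁)))
                                        (degree-bound D1 X1 feasible₁ v∈₁ d)
    ... | inj₂ (inj₂ (v∈₂ , v≢v2)) = subst₂ _≤_ (sym (degree-old₂ d v∈₂ v≢v2)) (cong length (sym (XM₂ v∈₂)))
                                        (degree-bound D2 X2 feasible₂ v∈₂ d)

  -- A colouring of one side glues with the greedy colouring of the other side
  -- minus its merge vertex.
  glue-side₁ : (As₁ As₂ : List (ℕ × ℕ)) →
    (∀ a b → (a , b) ∈ As₁ → (a , b) ∈ A H1) → (∀ a b → (a , b) ∈ As₂ → (a , b) ∈ A H2) →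
    Colorable D1 X1 (withArcs H1 As₁) → (∀ u → u ∈ V D2 → u ≢ v2 → ∀ d → degree d D2 u ≤ length (X2 u)) →
    Colorable M XM (mergeH (withArcs H1 As₁) (withArcs H2 As₂))
  glue-side₁ As₁ As₂ sub₁ sub₂ c₁ room with Greedy.transversal-but F2 v2 v2∈ room
  ... | _ , t₂ = glue As₁ As₂ sub₁ sub₂ (colouring⇒transversal v1∈ c₁) (transversal-mono As₂ sub₂ t₂) refl

  glue-side₂ : (As₁ As₂ : List (ℕ × ℕ)) →
    (∀ a b → (a , b) ∈ As₁ → (a , b) ∈ A H1) → (∀ a b → (a , b) ∈ As₂ → (a , b) ∈ A H2) →
    Colorable D2 X2 (withArcs H2 As₂) → (∀ u → u ∈ V D1 → u ≢ v1 → ∀ d → degree d D1 u ≤ length (X1 u)) →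
    Colorable M XM (mergeH (withArcs H1 As₁) (withArcs H2 As₂))
  glue-side₂ As₁ As₂ sub₁ sub₂ c₂ room with Greedy.transversal-but F1 v1 v1∈ room
  ... | _ , t₁ = glue As₁ As₂ sub₁ sub₂ (transversal-mono As₁ sub₁ t₁) (colouring⇒transversal v2∈ c₂) refl

  -- Deleting an arc a from HM deletes it from both sides.
  glue-deleted₁ : ∀ a → Colorable D1 X1 (deleteArc H1 a) →
    (∀ u → u ∈ V D2 → u ≢ v2 → ∀ d → degree d D2 u ≤ length (X2 u)) → Colorable M XM (deleteArc HM a)
  glue-deleted₁ a c₁ room = subst (Colorable M XM) (sym (deleteArc-mergeH H1 H2 a))
    (glue-side₁ (A (deleteArc H1 a)) (A (deleteArc H2 a)) (deleteArc-⊆ H1 a) (deleteArc-⊆ H2 a) c₁ room)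

  glue-deleted₂ : ∀ a → Colorable D2 X2 (deleteArc H2 a) →
    (∀ u → u ∈ V D1 → u ≢ v1 → ∀ d → degree d D1 u ≤ length (X1 u)) → Colorable M XM (deleteArc HM a)
  glue-deleted₂ a c₂ room = subst (Colorable M XM) (sym (deleteArc-mergeH H1 H2 a))
    (glue-side₂ (A (deleteArc H1 a)) (A (deleteArc H2 a)) (deleteArc-⊆ H1 a) (deleteArc-⊆ H2 a) c₂ room)

  -- A colouring of M - a for an arc a of H1 splits off a colouring of D1 - a,
  -- unless it colours D2, which does not contain a.
  split-deleted₁ : ∀ {a} → a ∈ A H1 → Colorable M XM (deleteArc HM a) → ¬ Colorable D2 X2 H2 →
    Colorable D1 X1 (deleteArc H1 a)
  split-deleted₁ {a} a∈₁ c uncol₂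
    with split (A (deleteArc H1 a)) (A (deleteArc H2 a)) (subst (Colorable M XM) (deleteArc-mergeH H1 H2 a) c)
  ... | inj₁ c₁ = c₁
  ... | inj₂ c₂ = ⊥-elim (uncol₂ (subst (Colorable D2 X2) (deleteArc-absent H2 a λ a∈₂ → arcs-apart a∈₁ a∈₂) c₂))

  split-deleted₂ : ∀ {a} → a ∈ A H2 → Colorable M XM (deleteArc HM a) → ¬ Colorable D1 X1 H1 →
    Colorable D2 X2 (deleteArc H2 a)
  split-deleted₂ {a} a∈₂ c uncol₁
    with split (A (deleteArc H1 a)) (A (deleteArc H2 a)) (subst (Colorable M XM) (deleteArc-mergeH H1 H2 a) c)
  ... | inj₂ c₂ = c₂
  ... | inj₁ c₁ = ⊥-elim (uncol₁ (subst (Colorable D1 X1) (deleteArc-absent H1 a λ a∈₁ → arcs-apart a∈₁ a∈₂) c₁))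

  -- If v1 lacked colours in some direction while M is degree-feasible, then v2
  -- would have slack in that direction and D2 would be colourable; symmetrically for v2.
  room-v1 : DegreeFeasible M XM → ¬ Colorable D2 X2 H2 → ∀ d → degree d D1 v1 ≤ length (X1 v1)
  room-v1 feasible uncol₂ d with degree d D1 v1 ≤? length (X1 v1)
  ... | yes fits  = fits
  ... | no lacks = ⊥-elim (uncol₂ (Greedy.colourable-by-slack F2 v2 v2∈ (room₂ feasible) d
                                     (slack-transfer (room-w feasible d) lacks)))

  room-v2 : DegreeFeasible M XM → ¬ Colorable D1 X1 H1 → ∀ d → degree d D2 v2 ≤ length (X2 v2)
  room-v2 feasible uncol₁ d with degree d D2 v2 ≤? length (X2 v2)
  ... | yes fits  = fits
  ... | no lacks = ⊥-elim (uncol₁ (Greedy.colourable-by-slack F1 v1 v1∈ (room₁ feasible) d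
                                     (slack-transfer (subst₂ _≤_ (+-comm (degree d D1 v1) _) (+-comm (length (X1 v1)) _)
                                                              (room-w feasible d)) lacks)))

  merge-MUDF : MUDF D1 X1 H1 × MUDF D2 X2 H2 → MUDF M XM HM
  merge-MUDF ((_ , feasible₁ , uncol₁ , minimal₁) , (_ , feasible₂ , uncol₂ , minimal₂)) =
    M-feasible , merge-degree-feasible feasible₁ feasible₂ , [ uncol₁ , uncol₂ ]′ ∘ split (A H1) (A H2) , minimal
    where
    minimal : ∀ a → a ∈ A HM → Colorable M XM (deleteArc HM a)
    minimal a a∈ with ∈-++⁻ (A H1) a∈
    ... | inj₁ a∈₁ = glue-deleted₁ a (minimal₁ a a∈₁) (λ u u∈ _ → degree-bound D2 X2 feasible₂ u∈)
    ... | inj₂ a∈₂ = glue-deleted₂ a (minimal₂ a a∈₂) (λ u u∈ _ → degree-bound D1 X1 feasible₁ u∈)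

  unmerge-MUDF : MUDF M XM HM → MUDF D1 X1 H1 × MUDF D2 X2 H2
  unmerge-MUDF (_ , feasible , uncol , minimal) =
    (F1 , degree-feasible D1 X1 bound₁ , uncol₁ , λ a a∈ → split-deleted₁ a∈ (minimal a (∈-++⁺ˡ a∈)) uncol₂) ,
    (F2 , degree-feasible D2 X2 bound₂ , uncol₂ , λ a a∈ → split-deleted₂ a∈ (minimal a (∈-++⁺ʳ (A H1) a∈)) uncol₁)
    where
    uncol₁ : ¬ Colorable D1 X1 H1
    uncol₁ c₁ = uncol (glue-side₁ (A H1) (A H2) (λ _ _ → id) (λ _ _ → id) c₁ (room₂ feasible))
    uncol₂ : ¬ Colorable D2 X2 H2
    uncol₂ c₂ = uncol (glue-side₂ (A H1) (A H2) (λ _ _ → id) (λ _ _ → id) c₂ (room₁ feasible))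
    bound₁ : ∀ u → u ∈ V D1 → ∀ d → degree d D1 u ≤ length (X1 u)
    bound₁ u u∈ with u ≟ v1
    ... | yes refl = room-v1 feasible uncol₂
    ... | no u≢v1  = room₁ feasible u u∈ u≢v1
    bound₂ : ∀ u → u ∈ V D2 → ∀ d → degree d D2 u ≤ length (X2 u)
    bound₂ u u∈ with u ≟ v2
    ... | yes refl = room-v2 feasible uncol₁
    ... | no u≢v2  = room₂ feasible u u∈ u≢v2

proposition10 : (D1 H1 D2 H2 : Digraph) (X1 X2 : ℕ → List ℕ) (v1 v2 w : ℕ) →
    Feasible D1 X1 H1 → Feasible D2 X2 H2 →
    Disjoint (V D1) (V D2) → Disjoint (V H1) (V H2) →
    v1 ∈ V D1 → v2 ∈ V D2 → w ∉ V D1 → w ∉ V D2 →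
    Feasible (mergeD D1 D2 v1 v2 w) (mergeX D1 X1 X2 v1 v2 w) (mergeH H1 H2) ×
    ((MUDF D1 X1 H1 × MUDF D2 X2 H2) ⇔
     MUDF (mergeD D1 D2 v1 v2 w) (mergeX D1 X1 X2 v1 v2 w) (mergeH H1 H2))
proposition10 D1 H1 D2 H2 X1 X2 v1 v2 w F1 F2 disjointD disjointH v1∈ v2∈ w∉1 w∉2 =
  M-feasible , mk⇔ merge-MUDF unmerge-MUDF
  where open Merge D1 H1 D2 H2 X1 X2 v1 v2 w F1 F2 disjointD disjointH v1∈ v2∈ w∉1 w∉2
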